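{- Let $m\geq 3$ and $n\in \mathbb{N}=\{1,2,\dots\}$. Then \[ \sigma'_m(n) =\sum_{k=0}^\infty (-1)^{k+1} \big( P_{m+2,k} \cdot p'_m(n-P_{m+2,k})+ Q_{m+2,k} \cdot p'_m(n-Q_{m+2,k})\big), \] where $P_{g,k}=\frac{k((g-2)k-(g-4))}{2}$ and $Q_{g,k}=\frac{k((g-2)k+(g-4))}{2}$ (both equal $0$ for $k=0$).
   Context: For $m\ge3$ and $n\in\mathbb{N}$, $\sigma'_m(n)$ is the sum of the positive divisors $d$ of $n$ with $d\equiv 0$, $1$ or $m-1 \pmod m$. $p'_m(n)$ is the number of partitions of $n$ in which every part is congruent to $0$, $1$ or $m-1$ modulo $m$, with $p'_m(0)=1$ and $p'_m(x)=0$ for $x\notin\mathbb{N}_0$; equivalently $\sum_{n\ge0}p'_m(n)q^n=1/\big((q;q^m)_\infty (q^{m-1};q^m)_\infty (q^m; q^m)_\infty\big)$. -}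

module Defs where

open import Data.Nat using (ℕ; zero; suc; _+_; _*_; _∸_; _≤_; _≥_; _≥?_; _≟_)
open import Data.Nat.Divisibility using (_∣_; _∣?_)
open import Data.Nat.DivMod using (_/_)
open import Data.Integer as ℤ using (ℤ; +_; -[1+_]; -1ℤ)
open import Data.List using (List; []; _∷_; map; filter; length; upTo; concatMap)
open import Data.Nat.ListAction using (sum)
open import Data.List.Relation.Unary.All using (All; all?)
open import Data.List.Relation.Unary.Linked using (Linked; linked?)
open import Data.Product using (_×_)
open import Data.Sum using (_⊎_)
open import Relation.Nullary using (Dec)
open import Relation.Nullary.Decidable using (_×-dec_; _⊎-dec_)
open import Relation.Binary.PropositionalEquality using (_≡_)

-- For a positive integer d:  d ≡ 0, 1 or m-1 (mod m), written via divisibility: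
--   d ≡ 0 (mod m)    iff  m ∣ d
--   d ≡ 1 (mod m)    iff  m ∣ d - 1        (d ≥ 1)
--   d ≡ m-1 (mod m)  iff  m ∣ d + 1
Allowed : ℕ → ℕ → Set
Allowed m d = m ∣ d ⊎ (m ∣ (d ∸ 1) ⊎ m ∣ (d + 1))

allowed? : (m d : ℕ) → Dec (Allowed m d)
allowed? m d = (m ∣? d) ⊎-dec ((m ∣? (d ∸ 1)) ⊎-dec (m ∣? (d + 1)))

σ′ : ℕ → ℕ → ℕ
σ′ m n = sum (filter (λ d → (d ∣? n) ×-dec allowed? m d) (map suc (upTo n)))

listsOfLen : ℕ → List ℕ → List (List ℕ)
listsOfLen zero    xs = [] ∷ []
listsOfLen (suc l) xs = concatMap (λ x → map (x ∷_) (listsOfLen l xs)) xs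

-- all lists of length ≤ n with entries in {1,…,n}; every partition of n
-- (as a non-increasing list of positive parts) occurs exactly once here
candidates : ℕ → List (List ℕ)
candidates n = concatMap (λ l → listsOfLen l (map suc (upTo n))) (upTo (suc n))

IsPartition′ : ℕ → ℕ → List ℕ → Set
IsPartition′ m n xs = Linked _≥_ xs × (sum xs ≡ n × All (Allowed m) xs)

isPartition′? : (m n : ℕ) (xs : List ℕ) → Dec (IsPartition′ m n xs)
isPartition′? m n xs = linked? _≥?_ xs ×-dec ((sum xs ≟ n) ×-dec all? (allowed? m) xs)

-- p'_m(n) for n ∈ ℕ₀ (p'_m(0) = 1, the empty partition)
p′ : ℕ → ℕ → ℕ
p′ m n = length (filter (isPartition′? m n) (candidates n))

p′ℤ : ℕ → ℤ → ℕ
p′ℤ m (+ n)    = p′ m n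
p′ℤ m -[1+ _ ] = 0

-- generalized pentagonal-type numbers (exact division by 2)
P : ℕ → ℕ → ℕ
P g k = (k * ((g ∸ 2) * k ∸ (g ∸ 4))) / 2

Q : ℕ → ℕ → ℕ
Q g k = (k * ((g ∸ 2) * k + (g ∸ 4))) / 2

term : ℕ → ℕ → ℕ → ℤ
term m n k = (-1ℤ ℤ.^ suc k) ℤ.*
  (+ (P (m + 2) k * p′ℤ m (+ n ℤ.- + P (m + 2) k))
   ℤ.+ + (Q (m + 2) k * p′ℤ m (+ n ℤ.- + Q (m + 2) k)))

sumTo : (ℕ → ℤ) → ℕ → ℤ
sumTo f zero    = f 0
sumTo f (suc N) = sumTo f N ℤ.+ f (suc N)

-- Let F = ∑ p′ₘ(n) qⁿ = ∏ (1 − q^d)⁻¹ over d ≡ 0, ±1 (mod m). Jacobi's triple product with base q^m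
-- turns 1/F into Θ = 1 + ∑_{k≥1} (−1)^k (q^{P_k} + q^{Q_k}), where P_k = P_{m+2,k}, Q_k = Q_{m+2,k}.
-- The logarithmic derivative of F is q F′/F = ∑ σ′ₘ(n) qⁿ, so applying q d/dq to Θ F = 1 gives
-- ∑ σ′ₘ(n) qⁿ = −(q Θ′) F, and comparing coefficients of qⁿ is the identity.
-- All series are integer sequences compared up to a degree N; in that range the triple product holds in the
-- finite form ∏_{k=1}^{2N} (1 − t^k)(1 − t^{k−1} q^{m−1})(1 − t^{k−1} q) ≡ Θ (mod q^{N+1}), t = q^m,
-- which follows from Rothe's q-binomial theorem.
module Submission where

open import Data.Nat using (ℕ; _≤_)

module PowerSeries where

  open import Data.Nat as ℕ using (zero; suc; _∸_; z≤n; s≤s; _<_)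
  import Data.Nat.Properties as NP
  open import Data.Integer using (ℤ; +_; 0ℤ; 1ℤ; _+_; _*_; -_; _-_)
  import Data.Integer.Properties as ZP
  open import Algebra.Properties.CommutativeSemigroup ZP.+-commutativeSemigroup using (interchange)
  open import Data.Integer.Tactic.RingSolver
  open import Data.List using (List; []; _∷_; _++_)
  open import Data.List.Relation.Unary.All using (All; []; _∷_)
  open import Data.Sum using (inj₁; inj₂)
  open import Relation.Nullary using (yes; no)
  open import Relation.Binary.PropositionalEquality
  open import Function using (_∘_)

  ∑ : ℕ → (ℕ → ℤ) → ℤ
  ∑ zero h = 0ℤ
  ∑ (suc n) h = h 0 + ∑ n (h ∘ suc)

  ∑-cong : ∀ n {h g : ℕ → ℤ} → (∀ i → i < n → h i ≡ g i) → ∑ n h ≡ ∑ n g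
  ∑-cong zero e = refl
  ∑-cong (suc n) e = cong₂ _+_ (e 0 (s≤s z≤n)) (∑-cong n (λ i p → e (suc i) (s≤s p)))

  ∑-cong′ : ∀ n {h g : ℕ → ℤ} → (∀ i → h i ≡ g i) → ∑ n h ≡ ∑ n g
  ∑-cong′ n e = ∑-cong n (λ i _ → e i)

  ∑-+ : ∀ n (h g : ℕ → ℤ) → ∑ n (λ i → h i + g i) ≡ ∑ n h + ∑ n g
  ∑-+ zero h g = refl
  ∑-+ (suc n) h g =
    trans (cong (λ x → (h 0 + g 0) + x) (∑-+ n (h ∘ suc) (g ∘ suc))) (interchange (h 0) (g 0) _ _)

  ∑-* : ∀ n c (h : ℕ → ℤ) → ∑ n (λ i → c * h i) ≡ c * ∑ n h
  ∑-* zero c h = sym (ZP.*-zeroʳ c)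
  ∑-* (suc n) c h = trans (cong (λ x → c * h 0 + x) (∑-* n c (h ∘ suc))) (sym (ZP.*-distribˡ-+ c (h 0) _))

  ∑-zero : ∀ n {h : ℕ → ℤ} → (∀ i → i < n → h i ≡ 0ℤ) → ∑ n h ≡ 0ℤ
  ∑-zero zero e = refl
  ∑-zero (suc n) e = cong₂ _+_ (e 0 (s≤s z≤n)) (∑-zero n (λ i p → e (suc i) (s≤s p)))

  ∑-snoc : ∀ n (h : ℕ → ℤ) → ∑ (suc n) h ≡ ∑ n h + h n
  ∑-snoc zero h = ZP.+-comm (h 0) 0ℤ
  ∑-snoc (suc n) h = trans (cong (λ x → h 0 + x) (∑-snoc n (h ∘ suc))) (sym (ZP.+-assoc (h 0) _ _))

  ∑-split : ∀ a b (h : ℕ → ℤ) → ∑ (a ℕ.+ b) h ≡ ∑ a h + ∑ b (λ i → h (a ℕ.+ i))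
  ∑-split zero b h = sym (ZP.+-identityˡ _)
  ∑-split (suc a) b h = trans (cong (λ x → h 0 + x) (∑-split a b (h ∘ suc))) (sym (ZP.+-assoc (h 0) _ _))

  ∑-reverse : ∀ n (h : ℕ → ℤ) → ∑ n h ≡ ∑ n (λ i → h (n ∸ suc i))
  ∑-reverse zero h = refl
  ∑-reverse (suc n) h = begin
      ∑ (suc n) h                      ≡⟨ ∑-snoc n h ⟩
      ∑ n h + h n                      ≡⟨ cong (_+ h n) (∑-reverse n h) ⟩
      ∑ n (λ i → h (n ∸ suc i)) + h n  ≡⟨ ZP.+-comm _ (h n) ⟩
      ∑ (suc n) (λ i → h (suc n ∸ suc i))  ∎
    where open ≡-Reasoning

  ∑-neg : ∀ n (h : ℕ → ℤ) → ∑ n (λ i → - h i) ≡ - ∑ n h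
  ∑-neg zero h = refl
  ∑-neg (suc n) h = trans (cong (λ x → - h 0 + x) (∑-neg n (h ∘ suc))) (sym (ZP.neg-distrib-+ (h 0) _))

  ∑-difference : ∀ a N (A B : ℕ → ℤ) → (a + ∑ N B) - ∑ N A ≡ a + ∑ N (λ i → - A i + B i)
  ∑-difference a N A B = begin
      (a + ∑ N B) - ∑ N A                   ≡⟨ rearrange a (∑ N A) (∑ N B) ⟩
      a + (- ∑ N A + ∑ N B)                 ≡⟨ cong (λ x → a + (x + ∑ N B)) (sym (∑-neg N A)) ⟩
      a + (∑ N (λ i → - A i) + ∑ N B)       ≡⟨ cong (λ x → a + x) (sym (∑-+ N (λ i → - A i) B)) ⟩
      a + ∑ N (λ i → - A i + B i)           ∎
    where open ≡-Reasoning
          rearrange : ∀ a x y → (a + y) - x ≡ a + (- x + y)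
          rearrange = solve-∀

  ∑-truncate : ∀ n r (h : ℕ → ℤ) → (∀ k → n ≤ k → h k ≡ 0ℤ) → ∑ (n ℕ.+ r) h ≡ ∑ n h
  ∑-truncate n r h vanish = begin
      ∑ (n ℕ.+ r) h                      ≡⟨ ∑-split n r h ⟩
      ∑ n h + ∑ r (λ i → h (n ℕ.+ i))    ≡⟨ cong (λ x → ∑ n h + x) (∑-zero r (λ i _ → vanish (n ℕ.+ i) (NP.m≤m+n n i))) ⟩
      ∑ n h + 0ℤ                         ≡⟨ ZP.+-identityʳ _ ⟩
      ∑ n h                              ∎
    where open ≡-Reasoning

  Series : Set
  Series = ℕ → ℤ

  infix 4 _≈_ _≈[_]_
  _≈_ : Series → Series → Set
  f ≈ g = ∀ n → f n ≡ g n

  _≈[_]_ : Series → ℕ → Series → Set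
  f ≈[ N ] g = ∀ n → n ≤ N → f n ≡ g n

  ≈⇒≈[] : ∀ {f g} N → f ≈ g → f ≈[ N ] g
  ≈⇒≈[] N e n _ = e n

  ≈[]-trans : ∀ {f g h N} → f ≈[ N ] g → g ≈[ N ] h → f ≈[ N ] h
  ≈[]-trans e1 e2 n p = trans (e1 n p) (e2 n p)

  ≈[]-sym : ∀ {f g N} → f ≈[ N ] g → g ≈[ N ] f
  ≈[]-sym e n p = sym (e n p)

  ≈[]-mono : ∀ {f g N M} → M ≤ N → f ≈[ N ] g → f ≈[ M ] g
  ≈[]-mono q e n p = e n (NP.≤-trans p q)

  ≈[]-suc : ∀ {f g} n → f ≈[ n ] g → f (suc n) ≡ g (suc n) → f ≈[ suc n ] g
  ≈[]-suc n e e′ i p with NP.m≤n⇒m<n∨m≡n p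
  ... | inj₁ (s≤s q) = e i q
  ... | inj₂ refl = e′

  1ₛ : Series
  1ₛ zero = 1ℤ
  1ₛ (suc n) = 0ℤ

  0ₛ : Series
  0ₛ _ = 0ℤ

  infixl 6 _⊕_ _⊖_
  _⊕_ : Series → Series → Series
  (f ⊕ g) n = f n + g n

  _⊖_ : Series → Series → Series
  (f ⊖ g) n = f n - g n

  scale : ℤ → Series → Series
  scale c f n = c * f n

  ∑ₛ : ℕ → (ℕ → Series) → Series
  ∑ₛ K H n = ∑ K (λ k → H k n)

  shift : ℕ → Series → Series
  shift zero f = f
  shift (suc a) f zero = 0ℤ
  shift (suc a) f (suc n) = shift a f n

  shift-< : ∀ a f n → n < a → shift a f n ≡ 0ℤ
  shift-< (suc a) f zero p = refl
  shift-< (suc a) f (suc n) (s≤s p) = shift-< a f n p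

  shift-+ : ∀ a f n → shift a f (a ℕ.+ n) ≡ f n
  shift-+ zero f n = refl
  shift-+ (suc a) f n = shift-+ a f n

  shift-≥ : ∀ a f n → a ≤ n → shift a f n ≡ f (n ∸ a)
  shift-≥ zero f n p = refl
  shift-≥ (suc a) f (suc n) (s≤s p) = shift-≥ a f n p

  shift-resp : ∀ a {f g} N → f ≈[ N ] g → shift a f ≈[ N ] shift a g
  shift-resp zero N e = e
  shift-resp (suc a) N e zero p = refl
  shift-resp (suc a) (suc N) e (suc n) (s≤s p) = shift-resp a N (λ i q → e i (NP.m≤n⇒m≤1+n q)) n p

  shift-cong : ∀ a {f g} → f ≈ g → shift a f ≈ shift a g
  shift-cong a e n = shift-resp a n (λ i _ → e i) n NP.≤-refl

  shift-shift : ∀ a b f → shift a (shift b f) ≈ shift (a ℕ.+ b) f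
  shift-shift zero b f n = refl
  shift-shift (suc a) b f zero = refl
  shift-shift (suc a) b f (suc n) = shift-shift a b f n

  shift-comm : ∀ a b f → shift a (shift b f) ≈ shift b (shift a f)
  shift-comm a b f n =
    trans (shift-shift a b f n) (trans (cong (λ c → shift c f n) (NP.+-comm a b)) (sym (shift-shift b a f n)))

  shift-cancel : ∀ c a f i → shift (c ℕ.+ a) f (c ℕ.+ i) ≡ shift a f i
  shift-cancel c a f i = trans (sym (shift-shift c a f (c ℕ.+ i))) (shift-+ c (shift a f) i)

  shift-⊕ : ∀ a f g → shift a (f ⊕ g) ≈ shift a f ⊕ shift a g
  shift-⊕ zero f g n = refl
  shift-⊕ (suc a) f g zero = refl
  shift-⊕ (suc a) f g (suc n) = shift-⊕ a f g n

  shift-⊖ : ∀ a f g → shift a (f ⊖ g) ≈ shift a f ⊖ shift a g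
  shift-⊖ zero f g n = refl
  shift-⊖ (suc a) f g zero = refl
  shift-⊖ (suc a) f g (suc n) = shift-⊖ a f g n

  shift-scale : ∀ a c f → shift a (scale c f) ≈ scale c (shift a f)
  shift-scale zero c f n = refl
  shift-scale (suc a) c f zero = sym (ZP.*-zeroʳ c)
  shift-scale (suc a) c f (suc n) = shift-scale a c f n

  shift-scale-shift : ∀ a c b f n → shift a (scale c (shift b f)) n ≡ c * shift (a ℕ.+ b) f n
  shift-scale-shift a c b f n = trans (shift-scale a c (shift b f) n) (cong (c *_) (shift-shift a b f n))

  shift-0ₛ : ∀ a → shift a 0ₛ ≈ 0ₛ
  shift-0ₛ zero n = refl
  shift-0ₛ (suc a) zero = refl
  shift-0ₛ (suc a) (suc n) = shift-0ₛ a n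

  shift-≈-beyond : ∀ a f g N → N < a → shift a f ≈[ N ] shift a g
  shift-≈-beyond a f g N q n p =
    trans (shift-< a f n (NP.≤-<-trans p q)) (sym (shift-< a g n (NP.≤-<-trans p q)))

  factor : ℕ → Series → Series
  factor d f = f ⊖ shift d f

  factor-resp : ∀ d {f g} N → f ≈[ N ] g → factor d f ≈[ N ] factor d g
  factor-resp d N e n p = cong₂ _-_ (e n p) (shift-resp d N e n p)

  factor-cong : ∀ d {f g} → f ≈ g → factor d f ≈ factor d g
  factor-cong d e n = cong₂ _-_ (e n) (shift-cong d e n)

  factor-≈-beyond : ∀ d f N → N < d → factor d f ≈[ N ] f
  factor-≈-beyond d f N q n p =
    trans (cong (λ x → f n - x) (shift-< d f n (NP.≤-<-trans p q))) (ZP.+-identityʳ (f n))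

  factor-+ : ∀ c e f → factor c f ⊕ shift c (factor e f) ≈ factor (c ℕ.+ e) f
  factor-+ c e f n = begin
      (f n - shift c f n) + shift c (factor e f) n
        ≡⟨ cong (λ x → (f n - shift c f n) + x) (shift-⊖ c f (shift e f) n) ⟩
      (f n - shift c f n) + (shift c f n - shift c (shift e f) n)
        ≡⟨ cong (λ x → (f n - shift c f n) + (shift c f n - x)) (shift-shift c e f n) ⟩
      (f n - shift c f n) + (shift c f n - shift (c ℕ.+ e) f n)
        ≡⟨ telescope (f n) (shift c f n) (shift (c ℕ.+ e) f n) ⟩
      f n - shift (c ℕ.+ e) f n
        ∎
    where open ≡-Reasoning
          telescope : ∀ x a b → (x - a) + (a - b) ≡ x - b
          telescope = solve-∀

  record LinearShiftInvariant (O : Series → Series) : Set where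
    field
      resp-≈ : ∀ {f g} → f ≈ g → O f ≈ O g
      ⊕-hom : ∀ f g → O (f ⊕ g) ≈ O f ⊕ O g
      scale-hom : ∀ c f → O (scale c f) ≈ scale c (O f)
      shift-hom : ∀ a f → O (shift a f) ≈ shift a (O f)
      0ₛ-hom : O 0ₛ ≈ 0ₛ

  module _ {O : Series → Series} (lsi : LinearShiftInvariant O) where
    open LinearShiftInvariant lsi

    ⊖-hom : ∀ f g → O (f ⊖ g) ≈ O f ⊖ O g
    ⊖-hom f g n = begin
        O (f ⊖ g) n                  ≡⟨ resp-≈ (λ k → cong (λ x → f k + x) (sym (ZP.-1*i≡-i (g k)))) n ⟩
        O (f ⊕ scale (- 1ℤ) g) n      ≡⟨ ⊕-hom f (scale (- 1ℤ) g) n ⟩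
        O f n + O (scale (- 1ℤ) g) n  ≡⟨ cong (λ x → O f n + x) (trans (scale-hom (- 1ℤ) g n) (ZP.-1*i≡-i _)) ⟩
        O f n - O g n                ∎
      where open ≡-Reasoning

    ∑ₛ-hom : ∀ K H → O (∑ₛ K H) ≈ ∑ₛ K (λ k → O (H k))
    ∑ₛ-hom zero H n = 0ₛ-hom n
    ∑ₛ-hom (suc K) H n = trans (⊕-hom (H 0) (∑ₛ K (H ∘ suc)) n) (cong (λ x → O (H 0) n + x) (∑ₛ-hom K (H ∘ suc) n))

    scale-shift-hom : ∀ c a f → O (scale c (shift a f)) ≈ scale c (shift a (O f))
    scale-shift-hom c a f n = trans (scale-hom c (shift a f) n) (cong (λ x → c * x) (shift-hom a f n))

    factor-hom : ∀ d f → O (factor d f) ≈ factor d (O f)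
    factor-hom d f n = trans (⊖-hom f (shift d f) n) (cong (λ x → O f n - x) (shift-hom d f n))

  id-lsi : LinearShiftInvariant (λ f → f)
  id-lsi = record
    { resp-≈ = λ e → e ; ⊕-hom = λ _ _ _ → refl ; scale-hom = λ _ _ _ → refl
    ; shift-hom = λ _ _ _ → refl ; 0ₛ-hom = λ _ → refl }

  lsi-∘ : ∀ {O O′} → LinearShiftInvariant O → LinearShiftInvariant O′ → LinearShiftInvariant (O ∘ O′)
  lsi-∘ {O} {O′} l l′ = record
    { resp-≈ = λ e → L.resp-≈ (L′.resp-≈ e)
    ; ⊕-hom = λ f g n → trans (L.resp-≈ (L′.⊕-hom f g) n) (L.⊕-hom (O′ f) (O′ g) n)
    ; scale-hom = λ c f n → trans (L.resp-≈ (L′.scale-hom c f) n) (L.scale-hom c (O′ f) n)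
    ; shift-hom = λ a f n → trans (L.resp-≈ (L′.shift-hom a f) n) (L.shift-hom a (O′ f) n)
    ; 0ₛ-hom = λ n → trans (L.resp-≈ L′.0ₛ-hom n) (L.0ₛ-hom n) }
    where module L = LinearShiftInvariant l
          module L′ = LinearShiftInvariant l′

  lsi-⊖ : ∀ {O O′} → LinearShiftInvariant O → LinearShiftInvariant O′ → LinearShiftInvariant (λ f → O f ⊖ O′ f)
  lsi-⊖ {O} {O′} l l′ = record
    { resp-≈ = λ e n → cong₂ _-_ (L.resp-≈ e n) (L′.resp-≈ e n)
    ; ⊕-hom = λ f g n → trans (cong₂ _-_ (L.⊕-hom f g n) (L′.⊕-hom f g n)) (+-minus-+ (O f n) (O g n) (O′ f n) (O′ g n))
    ; scale-hom = λ c f n → trans (cong₂ _-_ (L.scale-hom c f n) (L′.scale-hom c f n)) (*-minus-* c (O f n) (O′ f n))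
    ; shift-hom = λ a f n → trans (cong₂ _-_ (L.shift-hom a f n) (L′.shift-hom a f n)) (sym (shift-⊖ a (O f) (O′ f) n))
    ; 0ₛ-hom = λ n → cong₂ _-_ (L.0ₛ-hom n) (L′.0ₛ-hom n) }
    where module L = LinearShiftInvariant l
          module L′ = LinearShiftInvariant l′
          +-minus-+ : ∀ a b c d → (a + b) - (c + d) ≡ (a - c) + (b - d)
          +-minus-+ = solve-∀
          *-minus-* : ∀ c a b → c * a - c * b ≡ c * (a - b)
          *-minus-* = solve-∀

  shift-lsi : ∀ a → LinearShiftInvariant (shift a)
  shift-lsi a = record
    { resp-≈ = shift-cong a ; ⊕-hom = shift-⊕ a ; scale-hom = shift-scale a
    ; shift-hom = λ b f → shift-comm a b f ; 0ₛ-hom = shift-0ₛ a }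

  factor-lsi : ∀ d → LinearShiftInvariant (factor d)
  factor-lsi d = lsi-⊖ id-lsi (shift-lsi d)

  factors : List ℕ → Series → Series
  factors [] f = f
  factors (d ∷ ds) f = factor d (factors ds f)

  factors-lsi : ∀ ds → LinearShiftInvariant (factors ds)
  factors-lsi [] = id-lsi
  factors-lsi (d ∷ ds) = lsi-∘ (factor-lsi d) (factors-lsi ds)

  factors-resp : ∀ ds {f g} N → f ≈[ N ] g → factors ds f ≈[ N ] factors ds g
  factors-resp [] N e = e
  factors-resp (d ∷ ds) N e = factor-resp d N (factors-resp ds N e)

  factors-cong : ∀ ds {f g} → f ≈ g → factors ds f ≈ factors ds g
  factors-cong ds = LinearShiftInvariant.resp-≈ (factors-lsi ds)

  factors-factor : ∀ ds d f → factors ds (factor d f) ≈ factor d (factors ds f)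
  factors-factor ds = factor-hom (factors-lsi ds)

  factors-++ : ∀ ds es f → factors (ds ++ es) f ≡ factors ds (factors es f)
  factors-++ [] es f = refl
  factors-++ (d ∷ ds) es f = cong (factor d) (factors-++ ds es f)

  factor-injective : ∀ d {f g} N → factor (suc d) f ≈[ N ] factor (suc d) g → f ≈[ N ] g
  factor-injective d {f} {g} N e = up-to N NP.≤-refl
    where
    recover : ∀ (h : Series) n → h n ≡ factor (suc d) h n + shift (suc d) h n
    recover h n = minus-plus (h n) (shift (suc d) h n)
      where minus-plus : ∀ a b → a ≡ (a - b) + b
            minus-plus = solve-∀
    -- the coefficient of qⁿ in f is that of (1 − q^{d+1}) f plus one of strictly lower degree
    up-to : ∀ n → n ≤ N → f ≈[ n ] g
    up-to zero p zero z≤n = trans (recover f 0) (trans (cong (_+ 0ℤ) (e 0 z≤n)) (sym (recover g 0)))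
    up-to (suc n) p = ≈[]-suc n ih (begin
        f (suc n)                                                   ≡⟨ recover f (suc n) ⟩
        factor (suc d) f (suc n) + shift (suc d) f (suc n)          ≡⟨ cong₂ _+_ (e (suc n) p) (shift-resp d n ih n NP.≤-refl) ⟩
        factor (suc d) g (suc n) + shift (suc d) g (suc n)          ≡⟨ sym (recover g (suc n)) ⟩
        g (suc n)                                                   ∎)
      where open ≡-Reasoning
            ih = up-to n (NP.≤-trans (NP.n≤1+n n) p)

  factor-cancel : ∀ d {f g} → factor (suc d) f ≈ factor (suc d) g → f ≈ g
  factor-cancel d {f} {g} e n = factor-injective d {f} {g} n (λ i _ → e i) n NP.≤-refl

  factors-injective : ∀ ds {f g} N → All (1 ℕ.≤_) ds → factors ds f ≈[ N ] factors ds g → f ≈[ N ] g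
  factors-injective [] N _ e = e
  factors-injective (suc d ∷ ds) N (s≤s z≤n ∷ ps) e = factors-injective ds N ps (factor-injective d N e)

  conv : Series → Series → Series
  conv f g n = ∑ (suc n) (λ i → f i * g (n ∸ i))

  conv-cong : ∀ {f f′ g g′} → f ≈ f′ → g ≈ g′ → conv f g ≈ conv f′ g′
  conv-cong e₁ e₂ n = ∑-cong′ (suc n) (λ i → cong₂ _*_ (e₁ i) (e₂ (n ∸ i)))

  conv-congˡ : ∀ {f f′} g → f ≈ f′ → conv f g ≈ conv f′ g
  conv-congˡ g e = conv-cong e (λ _ → refl)

  conv-congʳ : ∀ f {g g′} → g ≈ g′ → conv f g ≈ conv f g′
  conv-congʳ f e = conv-cong {f} {f} (λ _ → refl) e

  conv-resp : ∀ {f f′ g g′} N → f ≈[ N ] f′ → g ≈[ N ] g′ → conv f g ≈[ N ] conv f′ g′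
  conv-resp N e₁ e₂ n p = ∑-cong (suc n) (λ i i≤n →
    cong₂ _*_ (e₁ i (NP.≤-trans (NP.≤-pred i≤n) p)) (e₂ (n ∸ i) (NP.≤-trans (NP.m∸n≤m n i) p)))

  conv-comm : ∀ f g → conv f g ≈ conv g f
  conv-comm f g n = trans (∑-reverse (suc n) (λ i → f i * g (n ∸ i))) (∑-cong (suc n) (λ i i≤n →
    trans (cong (λ j → f (n ∸ i) * g j) (NP.m∸[m∸n]≡n (NP.≤-pred i≤n))) (ZP.*-comm (f (n ∸ i)) (g i))))

  conv-1ₛˡ : ∀ g → conv 1ₛ g ≈ g
  conv-1ₛˡ g n = trans (cong₂ _+_ (ZP.*-identityˡ (g n)) (∑-zero n (λ i _ → ZP.*-zeroˡ (g (n ∸ suc i)))))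
                       (ZP.+-identityʳ (g n))

  conv-1ₛʳ : ∀ f → conv f 1ₛ ≈ f
  conv-1ₛʳ f n = trans (conv-comm f 1ₛ n) (conv-1ₛˡ f n)

  conv-shiftˡ : ∀ a f g → conv (shift a f) g ≈ shift a (conv f g)
  conv-shiftˡ zero f g n = refl
  conv-shiftˡ (suc a) f g zero = cong (_+ 0ℤ) (ZP.*-zeroˡ (g 0))
  conv-shiftˡ (suc a) f g (suc n) =
    trans (cong (λ x → x + conv (shift a f) g n) (ZP.*-zeroˡ (g (suc n)))) (trans (ZP.+-identityˡ _) (conv-shiftˡ a f g n))

  conv-shiftʳ : ∀ a f g → conv f (shift a g) ≈ shift a (conv f g)
  conv-shiftʳ a f g n =
    trans (conv-comm f (shift a g) n) (trans (conv-shiftˡ a g f n) (shift-cong a (conv-comm g f) n))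

  conv-⊕ʳ : ∀ f g h → conv f (g ⊕ h) ≈ conv f g ⊕ conv f h
  conv-⊕ʳ f g h n = trans (∑-cong′ (suc n) (λ i → ZP.*-distribˡ-+ (f i) (g (n ∸ i)) (h (n ∸ i))))
                          (∑-+ (suc n) (λ i → f i * g (n ∸ i)) (λ i → f i * h (n ∸ i)))

  conv-scaleʳ : ∀ c f g → conv f (scale c g) ≈ scale c (conv f g)
  conv-scaleʳ c f g n = trans (∑-cong′ (suc n) (λ i → *-left-comm (f i) c (g (n ∸ i))))
                              (∑-* (suc n) c (λ i → f i * g (n ∸ i)))
    where *-left-comm : ∀ a c b → a * (c * b) ≡ c * (a * b)
          *-left-comm = solve-∀

  conv-0ₛʳ : ∀ f → conv f 0ₛ ≈ 0ₛ
  conv-0ₛʳ f n = ∑-zero (suc n) (λ i _ → ZP.*-zeroʳ (f i))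

  conv-lsi : ∀ f → LinearShiftInvariant (conv f)
  conv-lsi f = record
    { resp-≈ = conv-congʳ f ; ⊕-hom = conv-⊕ʳ f ; scale-hom = λ c g → conv-scaleʳ c f g
    ; shift-hom = λ a g → conv-shiftʳ a f g ; 0ₛ-hom = conv-0ₛʳ f }

  conv-⊕ˡ : ∀ f g h → conv (f ⊕ g) h ≈ conv f h ⊕ conv g h
  conv-⊕ˡ f g h n = trans (conv-comm (f ⊕ g) h n)
    (trans (conv-⊕ʳ h f g n) (cong₂ _+_ (conv-comm h f n) (conv-comm h g n)))

  conv-scaleˡ : ∀ c f g → conv (scale c f) g ≈ scale c (conv f g)
  conv-scaleˡ c f g n = trans (conv-comm (scale c f) g n)
    (trans (conv-scaleʳ c g f n) (cong (c *_) (conv-comm g f n)))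

  conv-factorˡ : ∀ d f g → conv (factor d f) g ≈ factor d (conv f g)
  conv-factorˡ d f g n = trans (conv-comm (factor d f) g n)
    (trans (factor-hom (conv-lsi g) d f n) (factor-cong d (conv-comm g f) n))

  D : Series → Series
  D f n = + n * f n

  D-resp : ∀ {f g} N → f ≈[ N ] g → D f ≈[ N ] D g
  D-resp N e n p = cong (λ x → + n * x) (e n p)

  D-cong : ∀ {f g} → f ≈ g → D f ≈ D g
  D-cong e n = cong (λ x → + n * x) (e n)

  D-⊕ : ∀ f g → D (f ⊕ g) ≈ D f ⊕ D g
  D-⊕ f g n = ZP.*-distribˡ-+ (+ n) (f n) (g n)

  D-scale : ∀ c f → D (scale c f) ≈ scale c (D f)
  D-scale c f n = *-left-comm (+ n) c (f n)
    where *-left-comm : ∀ a c b → a * (c * b) ≡ c * (a * b)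
          *-left-comm = solve-∀

  D-∑ₛ : ∀ K H → D (∑ₛ K H) ≈ ∑ₛ K (λ k → D (H k))
  D-∑ₛ K H n = sym (∑-* K (+ n) (λ k → H k n))

  D-1ₛ : D 1ₛ ≈ 0ₛ
  D-1ₛ zero = refl
  D-1ₛ (suc n) = ZP.*-zeroʳ (+ suc n)

  D-shift : ∀ a f → D (shift a f) ≈ shift a (D f) ⊕ scale (+ a) (shift a f)
  D-shift a f n with a ℕ.≤? n
  ... | yes a≤n = begin
      + n * shift a f n                             ≡⟨ cong (λ x → + n * x) (shift-≥ a f n a≤n) ⟩
      + n * f (n ∸ a)                               ≡⟨ cong (λ x → x * f (n ∸ a)) (n≡n∸a+a a≤n) ⟩
      (+ (n ∸ a) + + a) * f (n ∸ a)                 ≡⟨ ZP.*-distribʳ-+ (f (n ∸ a)) (+ (n ∸ a)) (+ a) ⟩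
      D f (n ∸ a) + + a * f (n ∸ a)                 ≡⟨ sym (cong₂ (λ x y → x + + a * y) (shift-≥ a (D f) n a≤n) (shift-≥ a f n a≤n)) ⟩
      shift a (D f) n + + a * shift a f n           ∎
    where open ≡-Reasoning
          n≡n∸a+a : a ℕ.≤ n → + n ≡ + (n ∸ a) + + a
          n≡n∸a+a a≤n = trans (cong +_ (sym (NP.m∸n+n≡m a≤n))) (ZP.pos-+ (n ∸ a) a)
  ... | no a≰n = begin
      + n * shift a f n                             ≡⟨ cong (λ x → + n * x) (shift-< a f n a>n) ⟩
      + n * 0ℤ                                      ≡⟨ ZP.*-zeroʳ (+ n) ⟩
      0ℤ                                            ≡⟨ sym (ZP.*-zeroʳ (+ a)) ⟩
      + a * 0ℤ                                      ≡⟨ sym (ZP.+-identityˡ _) ⟩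
      0ℤ + + a * 0ℤ                                 ≡⟨ sym (cong₂ (λ x y → x + + a * y) (shift-< a (D f) n a>n) (shift-< a f n a>n)) ⟩
      shift a (D f) n + + a * shift a f n           ∎
    where open ≡-Reasoning
          a>n = NP.≰⇒> a≰n

  factor-D : ∀ d f → factor d (D f) ≈ D (factor d f) ⊕ scale (+ d) (shift d f)
  factor-D d f n = begin
      D f n - shift d (D f) n
        ≡⟨ rearrange (D f n) (shift d (D f) n) (+ d * shift d f n) ⟩
      (D f n - (shift d (D f) n + + d * shift d f n)) + + d * shift d f n
        ≡⟨ cong (λ x → (D f n - x) + + d * shift d f n) (sym (D-shift d f n)) ⟩
      (D f n - D (shift d f) n) + + d * shift d f n
        ≡⟨ cong (λ x → x + + d * shift d f n) (sym (*-distrib-minus (+ n) (f n) (shift d f n))) ⟩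
      D (factor d f) n + + d * shift d f n
        ∎
    where open ≡-Reasoning
          rearrange : ∀ a b c → a - b ≡ (a - (b + c)) + c
          rearrange = solve-∀
          *-distrib-minus : ∀ c a b → c * (a - b) ≡ c * a - c * b
          *-distrib-minus = solve-∀

module PartitionCounting (m : ℕ) where

  open import Data.Nat as ℕ using (zero; suc; _∸_; _+_; z≤n; s≤s; _<_; _≤?_; _≟_; _≥_)
  import Data.Nat.Properties as NP
  open import Algebra.Properties.CommutativeSemigroup NP.+-commutativeSemigroup using (interchange)
  open import Data.List using (List; []; _∷_; _++_; map; filter; length; upTo; applyUpTo; concatMap; [_])
  import Data.List.Properties as LP
  open import Data.Nat.ListAction using (sum)
  open import Data.Nat.ListAction.Properties using (sum-++)
  import Data.List.Relation.Unary.All as All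
  open All using (All; []; _∷_; all?)
  open import Data.List.Relation.Unary.Linked using (Linked; []; [-]; _∷_; linked?)
  open import Data.Product using (_×_; _,_; proj₁; proj₂)
  open import Data.Bool using (if_then_else_)
  open import Relation.Nullary using (Dec; yes; no; ¬_; does)
  open import Relation.Nullary.Decidable using (_×-dec_)
  open import Relation.Unary using (Pred; Decidable)
  open import Relation.Binary.PropositionalEquality hiding ([_])
  open import Data.Empty using (⊥-elim)
  open import Function using (_∘_)
  open import Level using (0ℓ)
  open import Defs

  module _ {A : Set} where

    length-filter-≐ : ∀ {P Q : Pred A 0ℓ} (P? : Decidable P) (Q? : Decidable Q) →
      (∀ x → P x → Q x) → (∀ x → Q x → P x) → ∀ xs → length (filter P? xs) ≡ length (filter Q? xs)
    length-filter-≐ P? Q? P⇒Q Q⇒P xs = cong length (LP.filter-≐ P? Q? ((λ {x} → P⇒Q x) , (λ {x} → Q⇒P x)) xs)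

    length-filter-none : ∀ {P : Pred A 0ℓ} (P? : Decidable P) → (∀ x → ¬ P x) → ∀ xs → length (filter P? xs) ≡ 0
    length-filter-none P? ¬P xs = cong length (LP.filter-none P? (All.universal ¬P xs))

    length-filter-concatMap : ∀ {B : Set} {P : Pred A 0ℓ} (P? : Decidable P) (f : B → List A) xs →
      length (filter P? (concatMap f xs)) ≡ sum (map (λ x → length (filter P? (f x))) xs)
    length-filter-concatMap P? f [] = refl
    length-filter-concatMap P? f (x ∷ xs) = begin
        length (filter P? (f x ++ concatMap f xs))                  ≡⟨ cong length (LP.filter-++ P? (f x) (concatMap f xs)) ⟩
        length (filter P? (f x) ++ filter P? (concatMap f xs))      ≡⟨ LP.length-++ (filter P? (f x)) ⟩
        length (filter P? (f x)) + length (filter P? (concatMap f xs))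
          ≡⟨ cong (length (filter P? (f x)) +_) (length-filter-concatMap P? f xs) ⟩
        length (filter P? (f x)) + sum (map (λ y → length (filter P? (f y))) xs)  ∎
      where open ≡-Reasoning

    length-filter-map : ∀ {B : Set} {P : Pred A 0ℓ} (P? : Decidable P) (g : B → A) ys →
      length (filter P? (map g ys)) ≡ length (filter (P? ∘ g) ys)
    length-filter-map P? g [] = refl
    length-filter-map P? g (y ∷ ys) with P? (g y)
    ... | yes _ = cong suc (length-filter-map P? g ys)
    ... | no _ = length-filter-map P? g ys

  ∑₁ : (ℕ → ℕ) → ℕ → ℕ
  ∑₁ h zero = 0
  ∑₁ h (suc b) = ∑₁ h b + h (suc b)

  ∑₁-cong : ∀ b {h g : ℕ → ℕ} → (∀ x → 1 ≤ x → x ≤ b → h x ≡ g x) → ∑₁ h b ≡ ∑₁ g b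
  ∑₁-cong zero e = refl
  ∑₁-cong (suc b) e = cong₂ _+_ (∑₁-cong b (λ x p q → e x p (NP.m≤n⇒m≤1+n q))) (e (suc b) (s≤s z≤n) NP.≤-refl)

  ∑₁-zero : ∀ b {h : ℕ → ℕ} → (∀ x → 1 ≤ x → x ≤ b → h x ≡ 0) → ∑₁ h b ≡ 0
  ∑₁-zero zero e = refl
  ∑₁-zero (suc b) e = cong₂ _+_ (∑₁-zero b (λ x p q → e x p (NP.m≤n⇒m≤1+n q))) (e (suc b) (s≤s z≤n) NP.≤-refl)

  ∑₁-extend : ∀ b r {h : ℕ → ℕ} → (∀ x → b < x → h x ≡ 0) → ∑₁ h (b + r) ≡ ∑₁ h b
  ∑₁-extend b zero e = cong (∑₁ _) (NP.+-identityʳ b)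
  ∑₁-extend b (suc r) {h} e = begin
      ∑₁ h (b + suc r)                  ≡⟨ cong (∑₁ h) (NP.+-suc b r) ⟩
      ∑₁ h (b + r) + h (suc (b + r))    ≡⟨ cong₂ _+_ (∑₁-extend b r e) (e (suc (b + r)) (s≤s (NP.m≤m+n b r))) ⟩
      ∑₁ h b + 0                        ≡⟨ NP.+-identityʳ _ ⟩
      ∑₁ h b                            ∎
    where open ≡-Reasoning

  ∑₁-suc : ∀ (h : ℕ → ℕ) n → ∑₁ h (suc n) ≡ h 1 + ∑₁ (h ∘ suc) n
  ∑₁-suc h zero = sym (NP.+-identityʳ (h 1))
  ∑₁-suc h (suc n) = trans (cong (_+ h (suc (suc n))) (∑₁-suc h n)) (NP.+-assoc (h 1) _ _)

  ∑₁-+ : ∀ (h g : ℕ → ℕ) b → ∑₁ (λ x → h x + g x) b ≡ ∑₁ h b + ∑₁ g b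
  ∑₁-+ h g zero = refl
  ∑₁-+ h g (suc b) =
    trans (cong (_+ (h (suc b) + g (suc b))) (∑₁-+ h g b)) (interchange (∑₁ h b) (∑₁ g b) (h (suc b)) (g (suc b)))

  ∑₁-restrict : ∀ b (h : ℕ → ℕ) M → b ≤ M → ∑₁ (λ x → if does (x ≤? b) then h x else 0) M ≡ ∑₁ h b
  ∑₁-restrict b h M b≤M = begin
      ∑₁ h≤b M               ≡⟨ cong (∑₁ h≤b) (sym (NP.m+[n∸m]≡n b≤M)) ⟩
      ∑₁ h≤b (b + (M ∸ b))   ≡⟨ ∑₁-extend b (M ∸ b) (λ x b<x → beyond x b<x (x ≤? b)) ⟩
      ∑₁ h≤b b               ≡⟨ ∑₁-cong b (λ x _ x≤b → within x x≤b (x ≤? b)) ⟩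
      ∑₁ h b                 ∎
    where
      open ≡-Reasoning
      h≤b = λ x → if does (x ≤? b) then h x else 0
      beyond : ∀ x → b < x → (d : Dec (x ≤ b)) → (if does d then h x else 0) ≡ 0
      beyond x b<x (yes x≤b) = ⊥-elim (NP.<⇒≱ b<x x≤b)
      beyond x b<x (no _) = refl
      within : ∀ x → x ≤ b → (d : Dec (x ≤ b)) → (if does d then h x else 0) ≡ h x
      within x x≤b (yes _) = refl
      within x x≤b (no x≰b) = ⊥-elim (x≰b x≤b)

  oneTo : ℕ → List ℕ
  oneTo M = map suc (upTo M)

  sum-map-oneTo : ∀ (h : ℕ → ℕ) M → sum (map h (oneTo M)) ≡ ∑₁ h M
  sum-map-oneTo h zero = refl
  sum-map-oneTo h (suc M) = begin
      sum (map h (map suc (upTo (suc M))))        ≡⟨ cong (λ z → sum (map h (map suc z))) (sym (LP.applyUpTo-∷ʳ (λ x → x) M)) ⟩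
      sum (map h (map suc (upTo M ++ [ M ])))     ≡⟨ cong (λ z → sum (map h z)) (LP.map-++ suc (upTo M) [ M ]) ⟩
      sum (map h (oneTo M ++ [ suc M ]))          ≡⟨ cong sum (LP.map-++ h (oneTo M) [ suc M ]) ⟩
      sum (map h (oneTo M) ++ [ h (suc M) ])      ≡⟨ sum-++ (map h (oneTo M)) [ h (suc M) ] ⟩
      sum (map h (oneTo M)) + (h (suc M) + 0)     ≡⟨ cong₂ _+_ (sum-map-oneTo h M) (NP.+-identityʳ _) ⟩
      ∑₁ h (suc M)                                ∎
    where open ≡-Reasoning

  sum-map-upTo : ∀ (h : ℕ → ℕ) n → sum (map h (upTo (suc n))) ≡ ∑₁ (h ∘ ℕ.pred) (suc n)
  sum-map-upTo h n = begin
      h 0 + sum (map h (applyUpTo suc n))   ≡⟨ cong (λ z → h 0 + sum (map h z)) (sym (LP.map-applyUpTo (λ x → x) suc n)) ⟩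
      h 0 + sum (map h (oneTo n))           ≡⟨ cong (h 0 +_) (sum-map-oneTo h n) ⟩
      h 0 + ∑₁ h n                          ≡⟨ sym (∑₁-suc (h ∘ ℕ.pred) n) ⟩
      ∑₁ (h ∘ ℕ.pred) (suc n)               ∎
    where open ≡-Reasoning

  usablePart? : (n x : ℕ) → Dec (Allowed m x × x ≤ n)
  usablePart? n x = allowed? m x ×-dec (x ≤? n)

  -- partitions of n into exactly l allowed parts, all at most b, counted by their largest part x
  partitionsOfLength : ℕ → ℕ → ℕ → ℕ
  partitionsOfLength zero zero b = 1
  partitionsOfLength zero (suc n) b = 0
  partitionsOfLength (suc l) n b =
    ∑₁ (λ x → if does (usablePart? n x) then partitionsOfLength l (n ∸ x) x else 0) b

  BoundedPartition : ℕ → ℕ → List ℕ → Set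
  BoundedPartition n b xs = Linked _≥_ (b ∷ xs) × (sum xs ≡ n × All (Allowed m) xs)

  boundedPartition? : ∀ n b xs → Dec (BoundedPartition n b xs)
  boundedPartition? n b xs = linked? ℕ._≥?_ (b ∷ xs) ×-dec ((sum xs ≟ n) ×-dec all? (allowed? m) xs)

  boundedPartition-∷⁻ : ∀ n b x ys → BoundedPartition n b (x ∷ ys) →
    (Allowed m x × x ≤ n) × (x ≤ b × BoundedPartition (n ∸ x) x ys)
  boundedPartition-∷⁻ n b x ys (x≤b ∷ lk , sm , ax ∷ as) =
    (ax , subst (x ≤_) sm (NP.m≤m+n x (sum ys))) , x≤b , lk , trans (sym (NP.m+n∸m≡n x (sum ys))) (cong (_∸ x) sm) , as

  boundedPartition-∷⁺ : ∀ n b x ys → (Allowed m x × x ≤ n) → x ≤ b → BoundedPartition (n ∸ x) x ys →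
    BoundedPartition n b (x ∷ ys)
  boundedPartition-∷⁺ n b x ys (ax , x≤n) x≤b (lk , sm , as) = x≤b ∷ lk , trans (cong (x +_) sm) (NP.m+[n∸m]≡n x≤n) , ax ∷ as

  isPartition⇒bounded : ∀ n xs → IsPartition′ m n xs → BoundedPartition n n xs
  isPartition⇒bounded n [] (lk , sm , as) = [-] , sm , as
  isPartition⇒bounded n (x ∷ xs) (lk , sm , as) = subst (x ≤_) sm (NP.m≤m+n x (sum xs)) ∷ lk , sm , as

  bounded⇒isPartition : ∀ n xs → BoundedPartition n n xs → IsPartition′ m n xs
  bounded⇒isPartition n [] (lk , sm , as) = [] , sm , as
  bounded⇒isPartition n (x ∷ xs) (_ ∷ lk , sm , as) = lk , sm , as

  listsCount : ℕ → ℕ → ℕ → ℕ → ℕ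
  listsCount M l n b = length (filter (boundedPartition? n b) (listsOfLen l (oneTo M)))

  listsCount-head : ∀ M l n b x → b ≤ M →
    (∀ n′ b′ → b′ ≤ M → listsCount M l n′ b′ ≡ partitionsOfLength l n′ b′) →
    (x≤b? : Dec (x ≤ b)) (usable? : Dec (Allowed m x × x ≤ n)) →
    length (filter (λ ys → boundedPartition? n b (x ∷ ys)) (listsOfLen l (oneTo M))) ≡
    (if does x≤b? then (if does usable? then partitionsOfLength l (n ∸ x) x else 0) else 0)
  listsCount-head M l n b x b≤M ih (yes x≤b) (yes usable) = trans
    (length-filter-≐ (λ ys → boundedPartition? n b (x ∷ ys)) (boundedPartition? (n ∸ x) x)
      (λ ys p → proj₂ (proj₂ (boundedPartition-∷⁻ n b x ys p))) (λ ys p → boundedPartition-∷⁺ n b x ys usable x≤b p)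
      (listsOfLen l (oneTo M)))
    (ih (n ∸ x) x (NP.≤-trans x≤b b≤M))
  listsCount-head M l n b x b≤M ih (yes x≤b) (no unusable) = length-filter-none (λ ys → boundedPartition? n b (x ∷ ys))
    (λ ys p → unusable (proj₁ (boundedPartition-∷⁻ n b x ys p))) (listsOfLen l (oneTo M))
  listsCount-head M l n b x b≤M ih (no x≰b) _ = length-filter-none (λ ys → boundedPartition? n b (x ∷ ys))
    (λ ys p → x≰b (proj₁ (proj₂ (boundedPartition-∷⁻ n b x ys p)))) (listsOfLen l (oneTo M))

  listsCount≡partitionsOfLength : ∀ M l n b → b ≤ M → listsCount M l n b ≡ partitionsOfLength l n b
  listsCount≡partitionsOfLength M zero zero b b≤M = refl
  listsCount≡partitionsOfLength M zero (suc n) b b≤M = refl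
  listsCount≡partitionsOfLength M (suc l) n b b≤M = begin
      length (filter (boundedPartition? n b) (concatMap (λ x → map (x ∷_) (listsOfLen l (oneTo M))) (oneTo M)))
        ≡⟨ length-filter-concatMap (boundedPartition? n b) (λ x → map (x ∷_) (listsOfLen l (oneTo M))) (oneTo M) ⟩
      sum (map (λ x → length (filter (boundedPartition? n b) (map (x ∷_) (listsOfLen l (oneTo M))))) (oneTo M))
        ≡⟨ cong sum (LP.map-cong by-head (oneTo M)) ⟩
      sum (map headed (oneTo M))
        ≡⟨ sum-map-oneTo headed M ⟩
      ∑₁ headed M
        ≡⟨ ∑₁-restrict b _ M b≤M ⟩
      partitionsOfLength (suc l) n b
        ∎
    where
      open ≡-Reasoning
      headed : ℕ → ℕ
      headed x = if does (x ≤? b) then (if does (usablePart? n x) then partitionsOfLength l (n ∸ x) x else 0) else 0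
      by-head : ∀ x → length (filter (boundedPartition? n b) (map (x ∷_) (listsOfLen l (oneTo M)))) ≡ headed x
      by-head x = trans (length-filter-map (boundedPartition? n b) (x ∷_) (listsOfLen l (oneTo M)))
        (listsCount-head M l n b x b≤M (λ n′ b′ → listsCount≡partitionsOfLength M l n′ b′) (x ≤? b) (usablePart? n x))

  -- partitions of n into allowed parts ≤ b; ∑₁ runs over 1 … n+1, hence the lengths ℕ.pred l = 0 … n
  boundedPartitions : ℕ → ℕ → ℕ
  boundedPartitions b n = ∑₁ (λ l → partitionsOfLength (ℕ.pred l) n b) (suc n)

  p′≡boundedPartitions : ∀ n → p′ m n ≡ boundedPartitions n n
  p′≡boundedPartitions n = begin
      length (filter (isPartition′? m n) (concatMap (λ l → listsOfLen l (oneTo n)) (upTo (suc n))))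
        ≡⟨ length-filter-concatMap (isPartition′? m n) (λ l → listsOfLen l (oneTo n)) (upTo (suc n)) ⟩
      sum (map (λ l → length (filter (isPartition′? m n) (listsOfLen l (oneTo n)))) (upTo (suc n)))
        ≡⟨ cong sum (LP.map-cong by-length (upTo (suc n))) ⟩
      sum (map (λ l → partitionsOfLength l n n) (upTo (suc n)))
        ≡⟨ sum-map-upTo (λ l → partitionsOfLength l n n) n ⟩
      boundedPartitions n n
        ∎
    where
      open ≡-Reasoning
      by-length : ∀ l → length (filter (isPartition′? m n) (listsOfLen l (oneTo n))) ≡ partitionsOfLength l n n
      by-length l = trans
        (length-filter-≐ (isPartition′? m n) (boundedPartition? n n) (isPartition⇒bounded n) (bounded⇒isPartition n)
          (listsOfLen l (oneTo n)))
        (listsCount≡partitionsOfLength n l n n NP.≤-refl)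

  if-does-zero : ∀ {P : Set} (d : Dec P) {v : ℕ} → (P → v ≡ 0) → (if does d then v else 0) ≡ 0
  if-does-zero (yes p) f = f p
  if-does-zero (no _) f = refl

  partitionsOfLength-vanish : ∀ l n b → n < l → partitionsOfLength l n b ≡ 0
  partitionsOfLength-vanish (suc l) n b n<1+l = ∑₁-zero b (λ x 1≤x _ → if-does-zero (usablePart? n x)
      (λ usable → partitionsOfLength-vanish l (n ∸ x) x (rest-short x 1≤x (proj₂ usable))))
    where rest-short : ∀ x → 1 ≤ x → x ≤ n → n ∸ x < l
          rest-short x 1≤x x≤n = NP.<-≤-trans (NP.∸-monoʳ-< {n} {x} {0} 1≤x x≤n) (NP.≤-pred n<1+l)

  boundedPartitions-zero : ∀ n → boundedPartitions 0 n ≡ partitionsOfLength 0 n 0 + 0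
  boundedPartitions-zero n = trans (∑₁-suc (λ l → partitionsOfLength (ℕ.pred l) n 0) n)
    (cong (partitionsOfLength 0 n 0 +_) (∑₁-zero n (λ { (suc x) _ _ → refl })))

  boundedPartitions-tail : ∀ b n (usable? : Dec (Allowed m (suc b) × suc b ≤ n)) →
    ∑₁ (λ x → if does usable? then partitionsOfLength (ℕ.pred x) (n ∸ suc b) (suc b) else 0) n ≡
    (if does usable? then boundedPartitions (suc b) (n ∸ suc b) else 0)
  boundedPartitions-tail b n (no _) = ∑₁-zero n (λ _ _ _ → refl)
  boundedPartitions-tail b n (yes (_ , b<n)) = begin
      ∑₁ h n                         ≡⟨ cong (∑₁ h) (sym (NP.m+[n∸m]≡n n′<n)) ⟩
      ∑₁ h (suc n′ + (n ∸ suc n′))   ≡⟨ ∑₁-extend (suc n′) (n ∸ suc n′)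
                                          (λ x lt → partitionsOfLength-vanish (ℕ.pred x) n′ (suc b) (pred-> x lt)) ⟩
      boundedPartitions (suc b) n′   ∎
    where
      open ≡-Reasoning
      n′ = n ∸ suc b
      h = λ x → partitionsOfLength (ℕ.pred x) n′ (suc b)
      n′<n : suc n′ ≤ n
      n′<n = NP.∸-monoʳ-< {n} {suc b} {0} (s≤s z≤n) b<n
      pred-> : ∀ x → suc n′ < x → n′ < ℕ.pred x
      pred-> (suc x) (s≤s p) = p

  partitionsOfLength-zero : ∀ n b b′ → partitionsOfLength 0 n b ≡ partitionsOfLength 0 n b′ + 0
  partitionsOfLength-zero zero b b′ = refl
  partitionsOfLength-zero (suc n) b b′ = refl

  boundedPartitions-suc : ∀ b n → boundedPartitions (suc b) n ≡
    boundedPartitions b n + (if does (usablePart? n (suc b)) then boundedPartitions (suc b) (n ∸ suc b) else 0)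
  boundedPartitions-suc b n = begin
      ∑₁ (λ l → partitionsOfLength (ℕ.pred l) n (suc b)) (suc n)
        ≡⟨ ∑₁-cong (suc n) (λ l 1≤l _ → split-largest l 1≤l) ⟩
      ∑₁ (λ l → partitionsOfLength (ℕ.pred l) n b + largest l) (suc n)
        ≡⟨ ∑₁-+ (λ l → partitionsOfLength (ℕ.pred l) n b) largest (suc n) ⟩
      boundedPartitions b n + ∑₁ largest (suc n)
        ≡⟨ cong (boundedPartitions b n +_) (∑₁-suc largest n) ⟩
      boundedPartitions b n + ∑₁ (largest ∘ suc) n
        ≡⟨ cong (boundedPartitions b n +_) (∑₁-cong n (λ { (suc x) _ _ → refl })) ⟩
      boundedPartitions b n + ∑₁ (λ x → if does (usablePart? n (suc b)) then partitionsOfLength (ℕ.pred x) (n ∸ suc b) (suc b) else 0) n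
        ≡⟨ cong (boundedPartitions b n +_) (boundedPartitions-tail b n (usablePart? n (suc b))) ⟩
      boundedPartitions b n + (if does (usablePart? n (suc b)) then boundedPartitions (suc b) (n ∸ suc b) else 0)
        ∎
    where
      open ≡-Reasoning
      -- partitions of length ℕ.pred l whose largest part is exactly b + 1
      largest : ℕ → ℕ
      largest zero = 0
      largest (suc zero) = 0
      largest (suc (suc l)) = if does (usablePart? n (suc b)) then partitionsOfLength l (n ∸ suc b) (suc b) else 0
      split-largest : ∀ l → 1 ≤ l → partitionsOfLength (ℕ.pred l) n (suc b) ≡ partitionsOfLength (ℕ.pred l) n b + largest l
      split-largest (suc zero) _ = partitionsOfLength-zero n (suc b) b
      split-largest (suc (suc l)) _ = refl

  boundedPartitions-stable : ∀ n r → boundedPartitions (n + r) n ≡ boundedPartitions n n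
  boundedPartitions-stable n zero = cong (λ b → boundedPartitions b n) (NP.+-identityʳ n)
  boundedPartitions-stable n (suc r) = begin
      boundedPartitions (n + suc r) n
        ≡⟨ cong (λ b → boundedPartitions b n) (NP.+-suc n r) ⟩
      boundedPartitions (suc (n + r)) n
        ≡⟨ boundedPartitions-suc (n + r) n ⟩
      boundedPartitions (n + r) n + (if does (usablePart? n (suc (n + r))) then boundedPartitions (suc (n + r)) (n ∸ suc (n + r)) else 0)
        ≡⟨ cong (boundedPartitions (n + r) n +_) (if-does-zero (usablePart? n (suc (n + r))) too-large) ⟩
      boundedPartitions (n + r) n + 0
        ≡⟨ trans (NP.+-identityʳ _) (boundedPartitions-stable n r) ⟩
      boundedPartitions n n
        ∎
    where open ≡-Reasoning
          too-large : Allowed m (suc (n + r)) × suc (n + r) ≤ n → boundedPartitions (suc (n + r)) (n ∸ suc (n + r)) ≡ 0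
          too-large (_ , le) = ⊥-elim (NP.<⇒≱ (s≤s (NP.m≤m+n n r)) le)

  p′≡boundedPartitions-≥ : ∀ n N → n ≤ N → p′ m n ≡ boundedPartitions N n
  p′≡boundedPartitions-≥ n N n≤N = begin
      p′ m n                             ≡⟨ p′≡boundedPartitions n ⟩
      boundedPartitions n n              ≡⟨ sym (boundedPartitions-stable n (N ∸ n)) ⟩
      boundedPartitions (n + (N ∸ n)) n  ≡⟨ cong (λ b → boundedPartitions b n) (NP.m+[n∸m]≡n n≤N) ⟩
      boundedPartitions N n              ∎
    where open ≡-Reasoning

module PartitionSeries (m : ℕ) where

  open import Data.Nat as ℕ using (zero; suc; _∸_; z≤n; s≤s; _<_)
  import Data.Nat.Properties as NP
  open import Data.Nat.Divisibility using (_∣_; _∣?_; ∣m+n∣m⇒∣n; ∣m∣n⇒∣m+n; ∣-refl; ∣⇒≤)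
  open import Data.Integer using (+_; 0ℤ; 1ℤ; _+_; _*_; _-_)
  import Data.Integer.Properties as ZP
  open import Data.Integer.Tactic.RingSolver
  open import Data.List using (List; []; _∷_; map; filter)
  open import Data.List.Relation.Unary.All using (All; []; _∷_)
  open import Data.Nat.ListAction using (sum)
  open import Data.Product using (_×_; _,_; proj₁)
  open import Data.Bool using (if_then_else_)
  open import Relation.Nullary using (Dec; yes; no; ¬_; does)
  open import Relation.Nullary.Decidable using (_×-dec_)
  open import Relation.Binary.PropositionalEquality
  open import Data.Empty using (⊥-elim)
  open import Defs
  open PowerSeries
  open PartitionCounting m

  consIf : ∀ {P : Set} → Dec P → ℕ → List ℕ → List ℕ
  consIf (yes _) x xs = x ∷ xs
  consIf (no _) x xs = xs

  allowedUpTo : ℕ → List ℕ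
  allowedUpTo zero = []
  allowedUpTo (suc b) = consIf (allowed? m (suc b)) (suc b) (allowedUpTo b)

  allowedUpTo-positive : ∀ b → All (1 ℕ.≤_) (allowedUpTo b)
  allowedUpTo-positive zero = []
  allowedUpTo-positive (suc b) with allowed? m (suc b)
  ... | yes _ = s≤s z≤n ∷ allowedUpTo-positive b
  ... | no _ = allowedUpTo-positive b

  boundedSeries : ℕ → Series
  boundedSeries b n = + boundedPartitions b n

  boundedSeries-zero : boundedSeries 0 ≈ 1ₛ
  boundedSeries-zero zero = refl
  boundedSeries-zero (suc n) = cong +_ (boundedPartitions-zero (suc n))

  factor-boundedSeries : ∀ b → Allowed m (suc b) → factor (suc b) (boundedSeries (suc b)) ≈ boundedSeries b
  factor-boundedSeries b a n = by-cases (usablePart? n (suc b)) (boundedPartitions-suc b n)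
    where
    Ψ = boundedPartitions
    by-cases : (usable? : Dec (Allowed m (suc b) × suc b ≤ n)) →
      Ψ (suc b) n ≡ Ψ b n ℕ.+ (if does usable? then Ψ (suc b) (n ∸ suc b) else 0) →
      + Ψ (suc b) n - shift (suc b) (boundedSeries (suc b)) n ≡ + Ψ b n
    by-cases (yes (_ , b<n)) recurrence = begin
        + Ψ (suc b) n - shift (suc b) (boundedSeries (suc b)) n
          ≡⟨ cong₂ _-_ (trans (cong +_ recurrence) (ZP.pos-+ (Ψ b n) (Ψ (suc b) (n ∸ suc b))))
                       (shift-≥ (suc b) (boundedSeries (suc b)) n b<n) ⟩
        (+ Ψ b n + + Ψ (suc b) (n ∸ suc b)) - + Ψ (suc b) (n ∸ suc b)
          ≡⟨ plus-minus (+ Ψ b n) (+ Ψ (suc b) (n ∸ suc b)) ⟩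
        + Ψ b n
          ∎
      where open ≡-Reasoning
            plus-minus : ∀ x y → (x + y) - y ≡ x
            plus-minus = solve-∀
    by-cases (no unusable) recurrence = trans
      (cong₂ _-_ (cong +_ (trans recurrence (NP.+-identityʳ _)))
                 (shift-< (suc b) (boundedSeries (suc b)) n (NP.≰⇒> (λ b<n → unusable (a , b<n)))))
      (ZP.+-identityʳ _)

  boundedSeries-skip : ∀ b → ¬ Allowed m (suc b) → boundedSeries (suc b) ≈ boundedSeries b
  boundedSeries-skip b ¬a n = by-cases (usablePart? n (suc b)) (boundedPartitions-suc b n)
    where
    Ψ = boundedPartitions
    by-cases : (usable? : Dec (Allowed m (suc b) × suc b ≤ n)) →
      Ψ (suc b) n ≡ Ψ b n ℕ.+ (if does usable? then Ψ (suc b) (n ∸ suc b) else 0) → + Ψ (suc b) n ≡ + Ψ b n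
    by-cases (yes (a , _)) _ = ⊥-elim (¬a a)
    by-cases (no _) recurrence = cong +_ (trans recurrence (NP.+-identityʳ _))

  factors-boundedSeries : ∀ b → factors (allowedUpTo b) (boundedSeries b) ≈ 1ₛ
  factors-boundedSeries zero = boundedSeries-zero
  factors-boundedSeries (suc b) with allowed? m (suc b)
  ... | yes a = λ n → trans (sym (factors-factor (allowedUpTo b) (suc b) (boundedSeries (suc b)) n))
                        (trans (factors-cong (allowedUpTo b) (factor-boundedSeries b a) n) (factors-boundedSeries b n))
  ... | no ¬a = λ n → trans (factors-cong (allowedUpTo b) (boundedSeries-skip b ¬a) n) (factors-boundedSeries b n)

  partitionSeries : Series
  partitionSeries n = + p′ m n

  partitionSeries≈boundedSeries : ∀ N b → N ≤ b → partitionSeries ≈[ N ] boundedSeries b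
  partitionSeries≈boundedSeries N b N≤b n n≤N = cong +_ (p′≡boundedPartitions-≥ n b (NP.≤-trans n≤N N≤b))

  multiples : ℕ → Series
  multiples d zero = 0ℤ
  multiples d (suc n) = if does (d ∣? suc n) then 1ℤ else 0ℤ

  if-does-cong : ∀ {P Q : Set} (p : Dec P) (q : Dec Q) → (P → Q) → (Q → P) → ∀ {X : Set} (x y : X) →
    (if does p then x else y) ≡ (if does q then x else y)
  if-does-cong (yes p) (yes q) f g x y = refl
  if-does-cong (yes p) (no ¬q) f g x y = ⊥-elim (¬q (f p))
  if-does-cong (no ¬p) (yes q) f g x y = ⊥-elim (¬p (g q))
  if-does-cong (no ¬p) (no ¬q) f g x y = refl

  multiples-< : ∀ d n → n < suc d → multiples (suc d) n ≡ 0ℤ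
  multiples-< d zero _ = refl
  multiples-< d (suc n) n<d = by-cases (suc d ∣? suc n)
    where by-cases : (d? : Dec (suc d ∣ suc n)) → (if does d? then 1ℤ else 0ℤ) ≡ 0ℤ
          by-cases (yes d∣n) = ⊥-elim (NP.<⇒≱ n<d (∣⇒≤ d∣n))
          by-cases (no _) = refl

  multiples-period : ∀ d k → multiples (suc d) (suc d ℕ.+ k) - multiples (suc d) k ≡ 1ₛ k
  multiples-period d zero = by-cases (suc d ∣? suc (d ℕ.+ 0))
    where by-cases : (d? : Dec (suc d ∣ suc (d ℕ.+ 0))) → (if does d? then 1ℤ else 0ℤ) - 0ℤ ≡ 1ℤ
          by-cases (yes _) = refl
          by-cases (no ∤) = ⊥-elim (∤ (subst (suc d ∣_) (cong suc (sym (NP.+-identityʳ d))) ∣-refl))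
  multiples-period d (suc k) = trans
    (cong (_- multiples (suc d) (suc k))
      (if-does-cong (suc d ∣? suc (d ℕ.+ suc k)) (suc d ∣? suc k) (λ p → ∣m+n∣m⇒∣n p ∣-refl) (λ p → ∣m∣n⇒∣m+n ∣-refl p) 1ℤ 0ℤ))
    (ZP.+-inverseʳ (multiples (suc d) (suc k)))

  factor-multiples : ∀ d → factor (suc d) (multiples (suc d)) ≈ shift (suc d) 1ₛ
  factor-multiples d n with n ℕ.<? suc d
  ... | yes n<d = trans (cong₂ _-_ (multiples-< d n n<d) (shift-< (suc d) (multiples (suc d)) n n<d))
                        (sym (shift-< (suc d) 1ₛ n n<d))
  ... | no n≮d = begin
      multiples (suc d) n - shift (suc d) (multiples (suc d)) n
        ≡⟨ cong (λ i → multiples (suc d) i - shift (suc d) (multiples (suc d)) i) (sym n≡d+k) ⟩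
      multiples (suc d) (suc d ℕ.+ k) - shift (suc d) (multiples (suc d)) (suc d ℕ.+ k)
        ≡⟨ cong (multiples (suc d) (suc d ℕ.+ k) -_) (shift-+ (suc d) (multiples (suc d)) k) ⟩
      multiples (suc d) (suc d ℕ.+ k) - multiples (suc d) k
        ≡⟨ multiples-period d k ⟩
      1ₛ k
        ≡⟨ sym (shift-+ (suc d) 1ₛ k) ⟩
      shift (suc d) 1ₛ (suc d ℕ.+ k)
        ≡⟨ cong (shift (suc d) 1ₛ) n≡d+k ⟩
      shift (suc d) 1ₛ n
        ∎
    where open ≡-Reasoning
          k = n ∸ suc d
          n≡d+k : suc d ℕ.+ k ≡ n
          n≡d+k = NP.m+[n∸m]≡n (NP.≮⇒≥ n≮d)

  factor-conv-multiples : ∀ d f → factor (suc d) (conv (scale (+ suc d) (multiples (suc d))) f) ≈ scale (+ suc d) (shift (suc d) f)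
  factor-conv-multiples d f n = begin
      factor (suc d) (conv G f) n
        ≡⟨ sym (conv-factorˡ (suc d) G f n) ⟩
      conv (factor (suc d) G) f n
        ≡⟨ conv-congˡ f (LinearShiftInvariant.scale-hom (factor-lsi (suc d)) (+ suc d) (multiples (suc d))) n ⟩
      conv (scale (+ suc d) (factor (suc d) (multiples (suc d)))) f n
        ≡⟨ conv-scaleˡ (+ suc d) (factor (suc d) (multiples (suc d))) f n ⟩
      + suc d * conv (factor (suc d) (multiples (suc d))) f n
        ≡⟨ cong (+ suc d *_) (conv-congˡ f (factor-multiples d) n) ⟩
      + suc d * conv (shift (suc d) 1ₛ) f n
        ≡⟨ cong (+ suc d *_) (trans (conv-shiftˡ (suc d) 1ₛ f n) (shift-cong (suc d) (conv-1ₛˡ f) n)) ⟩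
      + suc d * shift (suc d) f n
        ∎
    where open ≡-Reasoning
          G = scale (+ suc d) (multiples (suc d))

  addIf : ∀ {P : Set} → Dec P → Series → Series → Series
  addIf (yes _) f g = f ⊕ g
  addIf (no _) f g = f

  -- ∑_{allowed d ≤ b} d q^d / (1 − q^d), whose coefficients are the σ′ₘ-sums over divisors ≤ b
  divisorSeries : ℕ → Series
  divisorSeries zero = 0ₛ
  divisorSeries (suc b) = addIf (allowed? m (suc b)) (divisorSeries b) (scale (+ suc b) (multiples (suc b)))

  -- logarithmic derivative: each factor (1 − q^d)⁻¹ of the product contributes d q^d / (1 − q^d)
  D-boundedSeries : ∀ b → D (boundedSeries b) ≈ conv (divisorSeries b) (boundedSeries b)
  D-boundedSeries zero n = begin
      + n * boundedSeries 0 n       ≡⟨ cong (+ n *_) (boundedSeries-zero n) ⟩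
      D 1ₛ n                        ≡⟨ D-1ₛ n ⟩
      0ℤ                            ≡⟨ sym (trans (conv-comm 0ₛ (boundedSeries 0) n) (conv-0ₛʳ (boundedSeries 0) n)) ⟩
      conv 0ₛ (boundedSeries 0) n   ∎
    where open ≡-Reasoning
  D-boundedSeries (suc b) with allowed? m (suc b)
  ... | no ¬a = λ n → trans (D-cong (boundedSeries-skip b ¬a) n)
                        (trans (D-boundedSeries b n) (conv-congʳ (divisorSeries b) (λ k → sym (boundedSeries-skip b ¬a k)) n))
  ... | yes a = factor-cancel b (factor-D-Ψ a)
    where
    Ψ = boundedSeries (suc b)
    S = divisorSeries b
    G = scale (+ suc b) (multiples (suc b))
    factor-D-Ψ : Allowed m (suc b) → factor (suc b) (D Ψ) ≈ factor (suc b) (conv (S ⊕ G) Ψ)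
    factor-D-Ψ a n = begin
        factor (suc b) (D Ψ) n
          ≡⟨ factor-D (suc b) Ψ n ⟩
        D (factor (suc b) Ψ) n + + suc b * shift (suc b) Ψ n
          ≡⟨ cong₂ _+_ (trans (D-cong (factor-boundedSeries b a) n) (D-boundedSeries b n))
                       (sym (factor-conv-multiples b Ψ n)) ⟩
        conv S (boundedSeries b) n + factor (suc b) (conv G Ψ) n
          ≡⟨ cong (_+ factor (suc b) (conv G Ψ) n)
               (trans (conv-congʳ S (λ k → sym (factor-boundedSeries b a k)) n) (factor-hom (conv-lsi S) (suc b) Ψ n)) ⟩
        factor (suc b) (conv S Ψ) n + factor (suc b) (conv G Ψ) n
          ≡⟨ sym (LinearShiftInvariant.⊕-hom (factor-lsi (suc b)) (conv S Ψ) (conv G Ψ) n) ⟩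
        factor (suc b) (conv S Ψ ⊕ conv G Ψ) n
          ≡⟨ factor-cong (suc b) (λ k → sym (conv-⊕ˡ S G Ψ k)) n ⟩
        factor (suc b) (conv (S ⊕ G) Ψ) n
          ∎
      where open ≡-Reasoning

  D-partitionSeries : ∀ N → D partitionSeries ≈[ N ] conv (divisorSeries N) partitionSeries
  D-partitionSeries N n n≤N = begin
      D partitionSeries n                              ≡⟨ D-resp N F≈Ψ n n≤N ⟩
      D (boundedSeries N) n                            ≡⟨ D-boundedSeries N n ⟩
      conv (divisorSeries N) (boundedSeries N) n       ≡⟨ conv-resp {divisorSeries N} {divisorSeries N} N (λ _ _ → refl) (≈[]-sym F≈Ψ) n n≤N ⟩
      conv (divisorSeries N) partitionSeries n         ∎
    where open ≡-Reasoning
          F≈Ψ = partitionSeries≈boundedSeries N N NP.≤-refl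

  σ′Bounded : ℕ → ℕ → ℕ
  σ′Bounded b j = ∑₁ (λ d → if does ((d ∣? j) ×-dec allowed? m d) then d else 0) b

  divisorSeries-σ′Bounded : ∀ b j → divisorSeries b (suc j) ≡ + σ′Bounded b (suc j)
  divisorSeries-σ′Bounded zero j = refl
  divisorSeries-σ′Bounded (suc b) j = by-cases (allowed? m (suc b)) (allowed? m (suc b)) (suc b ∣? suc j)
    where
    -- allowed? m (suc b) occurs hidden in both sides, so it is abstracted twice
    by-cases : (a? a?′ : Dec (Allowed m (suc b))) (d? : Dec (suc b ∣ suc j)) →
      addIf a? (divisorSeries b) (scale (+ suc b) (multiples (suc b))) (suc j) ≡
      + (σ′Bounded b (suc j) ℕ.+ (if does (d? ×-dec a?′) then suc b else 0))
    by-cases (yes a) (yes _) d? = trans (cong₂ _+_ (divisorSeries-σ′Bounded b j) (summand d? (suc b ∣? suc j)))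
                                        (sym (ZP.pos-+ (σ′Bounded b (suc j)) _))
      where summand : (d? d?′ : Dec (suc b ∣ suc j)) →
                   + suc b * (if does d?′ then 1ℤ else 0ℤ) ≡ + (if does (d? ×-dec yes a) then suc b else 0)
            summand (yes _) (yes _) = ZP.*-identityʳ (+ suc b)
            summand (no _) (no _) = ZP.*-zeroʳ (+ suc b)
            summand (yes d∣j) (no d∤j) = ⊥-elim (d∤j d∣j)
            summand (no d∤j) (yes d∣j) = ⊥-elim (d∤j d∣j)
    by-cases (yes a) (no ¬a) d? = ⊥-elim (¬a a)
    by-cases (no ¬a) (yes a) d? = ⊥-elim (¬a a)
    by-cases (no ¬a) (no _) (yes _) = trans (divisorSeries-σ′Bounded b j) (cong +_ (sym (NP.+-identityʳ _)))
    by-cases (no ¬a) (no _) (no _) = trans (divisorSeries-σ′Bounded b j) (cong +_ (sym (NP.+-identityʳ _)))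

  sum-filter : ∀ {P : ℕ → Set} (P? : ∀ x → Dec (P x)) xs →
    sum (filter P? xs) ≡ sum (map (λ x → if does (P? x) then x else 0) xs)
  sum-filter P? [] = refl
  sum-filter P? (x ∷ xs) with P? x
  ... | yes _ = cong (x ℕ.+_) (sum-filter P? xs)
  ... | no _ = sum-filter P? xs

  σ′≡σ′Bounded : ∀ j → σ′ m j ≡ σ′Bounded j j
  σ′≡σ′Bounded j = trans (sum-filter (λ d → (d ∣? j) ×-dec allowed? m d) (oneTo j))
    (sum-map-oneTo (λ d → if does ((d ∣? j) ×-dec allowed? m d) then d else 0) j)

  σ′Bounded-stable : ∀ j r → σ′Bounded (suc j ℕ.+ r) (suc j) ≡ σ′Bounded (suc j) (suc j)
  σ′Bounded-stable j r = ∑₁-extend (suc j) r (λ d j<d → if-does-zero ((d ∣? suc j) ×-dec allowed? m d)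
    (λ d∣j → ⊥-elim (NP.<⇒≱ j<d (∣⇒≤ (proj₁ d∣j)))))

  divisorSeries≡σ′ : ∀ N j → suc j ≤ N → divisorSeries N (suc j) ≡ + σ′ m (suc j)
  divisorSeries≡σ′ N j j<N = begin
      divisorSeries N (suc j)                          ≡⟨ divisorSeries-σ′Bounded N j ⟩
      + σ′Bounded N (suc j)                            ≡⟨ cong (λ b → + σ′Bounded b (suc j)) (sym (NP.m+[n∸m]≡n j<N)) ⟩
      + σ′Bounded (suc j ℕ.+ (N ∸ suc j)) (suc j)      ≡⟨ cong +_ (σ′Bounded-stable j (N ∸ suc j)) ⟩
      + σ′Bounded (suc j) (suc j)                      ≡⟨ cong +_ (sym (σ′≡σ′Bounded (suc j))) ⟩
      + σ′ m (suc j)                                   ∎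
    where open ≡-Reasoning

module TripleProduct (m : ℕ) (m≥2 : 2 ≤ m) where

  open import Data.Nat as ℕ using (zero; suc; _∸_; z≤n; s≤s; _<_)
  import Data.Nat.Properties as NP
  open import Data.Integer using (ℤ; +_; 0ℤ; 1ℤ; _+_; _*_; -_; _-_)
  import Data.Integer.Properties as ZP
  open import Data.Integer.Tactic.RingSolver
  import Data.Nat.Tactic.RingSolver as NS
  open import Data.List using (List; []; _∷_; _++_)
  open import Relation.Binary.PropositionalEquality
  open import Relation.Nullary using (yes; no)
  open PowerSeries

  m≥1 : 1 ≤ m
  m≥1 = NP.≤-trans (s≤s z≤n) m≥2

  m≡1+[m∸1] : m ≡ suc (m ∸ 1)
  m≡1+[m∸1] = sym (NP.m+[n∸m]≡n m≥1)

  -- Gaussian binomial coefficients in the base t = q^m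
  gaussBinomial : ℕ → ℕ → Series
  gaussBinomial zero zero = 1ₛ
  gaussBinomial zero (suc j) = 0ₛ
  gaussBinomial (suc N) zero = 1ₛ
  gaussBinomial (suc N) (suc j) = gaussBinomial N j ⊕ shift (m ℕ.* suc j) (gaussBinomial N (suc j))

  gaussBinomial-> : ∀ N j → N < j → gaussBinomial N j ≈ 0ₛ
  gaussBinomial-> zero (suc j) _ n = refl
  gaussBinomial-> (suc N) (suc j) (s≤s N<j) n = cong₂ _+_ (gaussBinomial-> N j N<j n)
    (trans (shift-cong (m ℕ.* suc j) (gaussBinomial-> N (suc j) (NP.m<n⇒m<1+n N<j)) n) (shift-0ₛ (m ℕ.* suc j) n))

  gaussBinomial-zero : ∀ N → gaussBinomial N 0 ≈ 1ₛ
  gaussBinomial-zero zero n = refl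
  gaussBinomial-zero (suc N) n = refl

  gaussBinomial-diag : ∀ N → gaussBinomial N N ≈ 1ₛ
  gaussBinomial-diag zero n = refl
  gaussBinomial-diag (suc N) n = trans (cong₂ _+_ (gaussBinomial-diag N n)
      (trans (shift-cong (m ℕ.* suc N) (gaussBinomial-> N (suc N) NP.≤-refl) n) (shift-0ₛ (m ℕ.* suc N) n)))
    (ZP.+-identityʳ (1ₛ n))

  gaussBinomial-≡ : ∀ {N N′} j → N ≡ N′ → gaussBinomial N j ≈ gaussBinomial N′ j
  gaussBinomial-≡ j refl n = refl

  -- exponents of the q-Pochhammer symbol (t^{b+1}; t)_a
  tPowers : ℕ → ℕ → List ℕ
  tPowers b zero = []
  tPowers b (suc a) = m ℕ.* (b ℕ.+ suc a) ∷ tPowers b a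

  tPowers-split : ∀ b a c → tPowers b (a ℕ.+ c) ≡ tPowers (b ℕ.+ a) c ++ tPowers b a
  tPowers-split b a zero = cong (tPowers b) (NP.+-identityʳ a)
  tPowers-split b a (suc c) = trans (cong (tPowers b) (NP.+-suc a c))
      (cong₂ _∷_ (cong (m ℕ.*_) (regroup b a c)) (tPowers-split b a c))
    where regroup : ∀ b a c → b ℕ.+ suc (a ℕ.+ c) ≡ b ℕ.+ a ℕ.+ suc c
          regroup = NS.solve-∀

  factors-tPowers-split : ∀ b a c f → factors (tPowers b (a ℕ.+ c)) f ≡ factors (tPowers (b ℕ.+ a) c) (factors (tPowers b a) f)
  factors-tPowers-split b a c f = trans (cong (λ ds → factors ds f) (tPowers-split b a c)) (factors-++ (tPowers (b ℕ.+ a) c) (tPowers b a) f)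

  factors-tPowers-lowest : ∀ b a f → factors (tPowers b (suc a)) f ≡ factors (tPowers (suc b) a) (factor (m ℕ.* suc b) f)
  factors-tPowers-lowest b a f = trans (factors-tPowers-split b 1 a f)
    (cong (λ c → factors (tPowers c a) (factor (m ℕ.* c) f)) (NP.+-comm b 1))

  factors-gaussBinomial : ∀ a b → factors (tPowers 0 a) (gaussBinomial (a ℕ.+ b) a) ≈ factors (tPowers b a) 1ₛ
  factors-gaussBinomial zero b n = gaussBinomial-zero b n
  factors-gaussBinomial (suc a) zero n = factors-cong (tPowers 0 (suc a))
    (λ k → trans (gaussBinomial-≡ (suc a) (NP.+-identityʳ (suc a)) k) (gaussBinomial-diag (suc a) k)) n
  factors-gaussBinomial (suc a) (suc b) n = begin
      factors R (Y ⊕ shift c Z) n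
        ≡⟨ LinearShiftInvariant.⊕-hom (factors-lsi R) Y (shift c Z) n ⟩
      factors R Y n + factors R (shift c Z) n
        ≡⟨ cong (λ x → factors R Y n + x) (LinearShiftInvariant.shift-hom (factors-lsi R) c Z n) ⟩
      factor c (factors (tPowers 0 a) Y) n + shift c (factors R Z) n
        ≡⟨ cong₂ _+_ (factor-cong c (factors-gaussBinomial a (suc b)) n)
                     (shift-cong c (λ k → trans (factors-cong R (gaussBinomial-≡ (suc a) (NP.+-suc a b)) k) (factors-gaussBinomial (suc a) b k)) n) ⟩
      factor c X n + shift c (factors (tPowers b (suc a)) 1ₛ) n
        ≡⟨ cong (λ x → factor c X n + x) (shift-cong c (λ k → trans (cong (λ g → g k) (factors-tPowers-lowest b a 1ₛ))
                                                         (factors-factor (tPowers (suc b) a) (m ℕ.* suc b) 1ₛ k)) n) ⟩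
      factor c X n + shift c (factor (m ℕ.* suc b) X) n
        ≡⟨ factor-+ c (m ℕ.* suc b) X n ⟩
      factor (c ℕ.+ m ℕ.* suc b) X n
        ≡⟨ cong (λ e → factor e X n) (distrib m a b) ⟩
      factors (tPowers (suc b) (suc a)) 1ₛ n
        ∎
    where
      open ≡-Reasoning
      R = tPowers 0 (suc a)
      c = m ℕ.* suc a
      Y = gaussBinomial (a ℕ.+ suc b) a
      Z = gaussBinomial (a ℕ.+ suc b) (suc a)
      X = factors (tPowers (suc b) a) 1ₛ
      distrib : ∀ m a b → m ℕ.* suc a ℕ.+ m ℕ.* suc b ≡ m ℕ.* (suc b ℕ.+ suc a)
      distrib = NS.solve-∀

  triangular : ℕ → ℕ
  triangular zero = 0
  triangular (suc j) = triangular j ℕ.+ j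

  triangular-+ : ∀ a b → triangular (a ℕ.+ b) ≡ triangular a ℕ.+ triangular b ℕ.+ a ℕ.* b
  triangular-+ a zero = trans (cong triangular (NP.+-identityʳ a)) (sym (plus-zero (triangular a) a))
    where plus-zero : ∀ t a → t ℕ.+ 0 ℕ.+ a ℕ.* 0 ≡ t
          plus-zero = NS.solve-∀
  triangular-+ a (suc b) = trans (cong triangular (NP.+-suc a b))
      (trans (cong (ℕ._+ (a ℕ.+ b)) (triangular-+ a b)) (regroup (triangular a) (triangular b) a b))
    where regroup : ∀ ta tb a b → ta ℕ.+ tb ℕ.+ a ℕ.* b ℕ.+ (a ℕ.+ b) ≡ ta ℕ.+ (tb ℕ.+ b) ℕ.+ a ℕ.* suc b
          regroup = NS.solve-∀

  triangular-double : ∀ x → triangular (suc x) ℕ.+ triangular (suc x) ≡ x ℕ.* suc x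
  triangular-double zero = refl
  triangular-double (suc x) = begin
      triangular (suc x) ℕ.+ suc x ℕ.+ (triangular (suc x) ℕ.+ suc x)
        ≡⟨ regroup (triangular (suc x)) x ⟩
      triangular (suc x) ℕ.+ triangular (suc x) ℕ.+ (x ℕ.+ suc x) ℕ.+ 1
        ≡⟨ cong (λ t → t ℕ.+ (x ℕ.+ suc x) ℕ.+ 1) (triangular-double x) ⟩
      x ℕ.* suc x ℕ.+ (x ℕ.+ suc x) ℕ.+ 1
        ≡⟨ square x ⟩
      suc x ℕ.* suc (suc x)
        ∎
    where open ≡-Reasoning
          regroup : ∀ t x → t ℕ.+ suc x ℕ.+ (t ℕ.+ suc x) ≡ t ℕ.+ t ℕ.+ (x ℕ.+ suc x) ℕ.+ 1
          regroup = NS.solve-∀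
          square : ∀ x → x ℕ.* suc x ℕ.+ (x ℕ.+ suc x) ℕ.+ 1 ≡ suc x ℕ.* suc (suc x)
          square = NS.solve-∀

  triangular-square : ∀ k → triangular k ℕ.+ triangular k ℕ.+ k ≡ k ℕ.* k
  triangular-square zero = refl
  triangular-square (suc j) = trans (cong (ℕ._+ suc j) (triangular-double j)) (square j)
    where square : ∀ j → j ℕ.* suc j ℕ.+ suc j ≡ suc j ℕ.* suc j
          square = NS.solve-∀

  sign : ℕ → ℤ
  sign zero = 1ℤ
  sign (suc j) = - sign j

  sign-+ : ∀ a b → sign (a ℕ.+ b) ≡ sign a * sign b
  sign-+ zero b = sym (ZP.*-identityˡ (sign b))
  sign-+ (suc a) b = trans (cong -_ (sign-+ a b)) (ZP.neg-distribˡ-* (sign a) (sign b))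

  sign-square : ∀ a → sign a * sign a ≡ 1ℤ
  sign-square zero = refl
  sign-square (suc a) = trans (neg-square (sign a)) (sign-square a)
    where neg-square : ∀ x → (- x) * (- x) ≡ x * x
          neg-square = solve-∀

  sign-cancel : ∀ a {x y} → sign a * x ≡ sign a * y → x ≡ y
  sign-cancel a {x} {y} e = begin
      x                       ≡⟨ sym (ZP.*-identityˡ x) ⟩
      1ℤ * x                  ≡⟨ cong (λ s → s * x) (sym (sign-square a)) ⟩
      sign a * sign a * x     ≡⟨ ZP.*-assoc (sign a) (sign a) x ⟩
      sign a * (sign a * x)   ≡⟨ cong (λ x → sign a * x) e ⟩
      sign a * (sign a * y)   ≡⟨ sym (ZP.*-assoc (sign a) (sign a) y) ⟩
      sign a * sign a * y     ≡⟨ cong (λ x → x * y) (sign-square a) ⟩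
      1ℤ * y                  ≡⟨ ZP.*-identityˡ y ⟩
      y                       ∎
    where open ≡-Reasoning

  sign-∸ : ∀ n l → suc l ≤ n → sign (n ∸ suc l) ≡ sign n * sign (suc l)
  sign-∸ n l l<n = sym (begin
      sign n * sign (suc l)                                 ≡⟨ cong (λ k → sign k * sign (suc l)) (sym (NP.m∸n+n≡m l<n)) ⟩
      sign (n ∸ suc l ℕ.+ suc l) * sign (suc l)             ≡⟨ cong (λ x → x * sign (suc l)) (sign-+ (n ∸ suc l) (suc l)) ⟩
      sign (n ∸ suc l) * sign (suc l) * sign (suc l)        ≡⟨ ZP.*-assoc (sign (n ∸ suc l)) (sign (suc l)) (sign (suc l)) ⟩
      sign (n ∸ suc l) * (sign (suc l) * sign (suc l))      ≡⟨ cong (λ x → sign (n ∸ suc l) * x) (sign-square (suc l)) ⟩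
      sign (n ∸ suc l) * 1ℤ                                 ≡⟨ ZP.*-identityʳ _ ⟩
      sign (n ∸ suc l)                                      ∎)
    where open ≡-Reasoning

  monomialDiff : ℕ → ℕ → Series → Series
  monomialDiff v u g = shift v g ⊖ shift u g

  monomialDiff-lsi : ∀ v u → LinearShiftInvariant (monomialDiff v u)
  monomialDiff-lsi v u = lsi-⊖ (shift-lsi v) (shift-lsi u)

  -- multiplication by ∏_{i < N} (q^v − q^{u + m i})
  rotheProduct : ℕ → ℕ → ℕ → Series → Series
  rotheProduct v zero u f = f
  rotheProduct v (suc N) u f = monomialDiff v u (rotheProduct v N (u ℕ.+ m) f)

  rotheProduct-lsi : ∀ v N u → LinearShiftInvariant (rotheProduct v N u)
  rotheProduct-lsi v zero u = id-lsi
  rotheProduct-lsi v (suc N) u = lsi-∘ (monomialDiff-lsi v u) (rotheProduct-lsi v N (u ℕ.+ m))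

  rotheExponent : ℕ → ℕ → ℕ → ℕ → ℕ
  rotheExponent v N u j = m ℕ.* triangular j ℕ.+ u ℕ.* j ℕ.+ v ℕ.* (N ∸ j)

  rotheTerm : ℕ → ℕ → ℕ → ℕ → Series
  rotheTerm v N u j = scale (sign j) (shift (rotheExponent v N u j) (gaussBinomial N j))

  rotheExponent-zero : ∀ v N u → v ℕ.+ rotheExponent v N (u ℕ.+ m) 0 ≡ rotheExponent v (suc N) u 0
  rotheExponent-zero v N u = identity m u v N
    where identity : ∀ m u v N → v ℕ.+ (m ℕ.* 0 ℕ.+ (u ℕ.+ m) ℕ.* 0 ℕ.+ v ℕ.* N) ≡ m ℕ.* 0 ℕ.+ u ℕ.* 0 ℕ.+ v ℕ.* suc N
          identity = NS.solve-∀

  rotheExponent-lowerShift : ∀ v N u j → u ℕ.+ rotheExponent v N (u ℕ.+ m) j ≡ rotheExponent v (suc N) u (suc j)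
  rotheExponent-lowerShift v N u j = identity m u v (triangular j) j (N ∸ j)
    where identity : ∀ m u v t j w → u ℕ.+ (m ℕ.* t ℕ.+ (u ℕ.+ m) ℕ.* j ℕ.+ v ℕ.* w) ≡ m ℕ.* (t ℕ.+ j) ℕ.+ u ℕ.* suc j ℕ.+ v ℕ.* w
          identity = NS.solve-∀

  rotheExponent-upperShift : ∀ v N u j → suc j ≤ N →
    v ℕ.+ rotheExponent v N (u ℕ.+ m) (suc j) ≡ rotheExponent v (suc N) u (suc j) ℕ.+ m ℕ.* suc j
  rotheExponent-upperShift v N u j j<N = trans (identity m u v (triangular (suc j)) j (N ∸ suc j))
      (cong (λ w → m ℕ.* triangular (suc j) ℕ.+ u ℕ.* suc j ℕ.+ v ℕ.* w ℕ.+ m ℕ.* suc j) (sym (NP.+-∸-assoc 1 j<N)))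
    where identity : ∀ m u v t j w → v ℕ.+ (m ℕ.* t ℕ.+ (u ℕ.+ m) ℕ.* suc j ℕ.+ v ℕ.* w)
                                     ≡ m ℕ.* t ℕ.+ u ℕ.* suc j ℕ.+ v ℕ.* suc w ℕ.+ m ℕ.* suc j
          identity = NS.solve-∀

  rothe-lowerSum : ∀ v N u n → ∑ (suc N) (λ j → shift u (rotheTerm v N (u ℕ.+ m) j) n) ≡
    ∑ (suc N) (λ j → sign j * shift (rotheExponent v (suc N) u (suc j)) (gaussBinomial N j) n)
  rothe-lowerSum v N u n = ∑-cong′ (suc N) (λ j → trans (shift-scale-shift u (sign j) _ (gaussBinomial N j) n)
    (cong (λ e → sign j * shift e (gaussBinomial N j) n) (rotheExponent-lowerShift v N u j)))

  rothe-upperSum : ∀ v N u n → ∑ (suc N) (λ j → shift v (rotheTerm v N (u ℕ.+ m) j) n) ≡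
    sign 0 * shift (rotheExponent v (suc N) u 0) 1ₛ n +
    ∑ (suc N) (λ j → - sign j * shift (rotheExponent v (suc N) u (suc j) ℕ.+ m ℕ.* suc j) (gaussBinomial N (suc j)) n)
  rothe-upperSum v N u n = begin
      shift v (T 0) n + ∑ N (λ j → shift v (T (suc j)) n)
        ≡⟨ cong₂ _+_ first (∑-cong N (λ j j<N → later j j<N)) ⟩
      sign 0 * shift (E 0) 1ₛ n + ∑ N B
        ≡⟨ cong (λ x → sign 0 * shift (E 0) 1ₛ n + x) (sym (trans (∑-snoc N B) (trans (cong (λ x → ∑ N B + x) B-last) (ZP.+-identityʳ _)))) ⟩
      sign 0 * shift (E 0) 1ₛ n + ∑ (suc N) B
        ∎
    where
      open ≡-Reasoning
      T = rotheTerm v N (u ℕ.+ m)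
      E = rotheExponent v (suc N) u
      B = λ j → - sign j * shift (E (suc j) ℕ.+ m ℕ.* suc j) (gaussBinomial N (suc j)) n
      first : shift v (T 0) n ≡ sign 0 * shift (E 0) 1ₛ n
      first = trans (shift-scale-shift v (sign 0) _ (gaussBinomial N 0) n)
        (cong (λ x → sign 0 * x) (trans (cong (λ e → shift e (gaussBinomial N 0) n) (rotheExponent-zero v N u))
                                 (shift-cong (E 0) (gaussBinomial-zero N) n)))
      later : ∀ j → j < N → shift v (T (suc j)) n ≡ B j
      later j j<N = trans (shift-scale-shift v (sign (suc j)) _ (gaussBinomial N (suc j)) n)
        (cong (λ e → - sign j * shift e (gaussBinomial N (suc j)) n) (rotheExponent-upperShift v N u j j<N))
      B-last : B N ≡ 0ℤ
      B-last = trans (cong (λ x → - sign N * x) (trans (shift-cong e (gaussBinomial-> N (suc N) NP.≤-refl) n) (shift-0ₛ e n)))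
                     (ZP.*-zeroʳ (- sign N))
        where e = E (suc N) ℕ.+ m ℕ.* suc N

  rothe-pascal : ∀ v N u n j →
    - (sign j * shift (rotheExponent v (suc N) u (suc j)) (gaussBinomial N j) n) +
    - sign j * shift (rotheExponent v (suc N) u (suc j) ℕ.+ m ℕ.* suc j) (gaussBinomial N (suc j)) n ≡
    rotheTerm v (suc N) u (suc j) n
  rothe-pascal v N u n j = begin
      - (sign j * x) + - sign j * y       ≡⟨ cong (λ x → x + - sign j * y) (ZP.neg-distribˡ-* (sign j) x) ⟩
      - sign j * x + - sign j * y         ≡⟨ sym (ZP.*-distribˡ-+ (- sign j) x y) ⟩
      - sign j * (x + y)                  ≡⟨ cong (λ z → - sign j * z) (sym (trans (shift-⊕ e _ _ n) (cong (λ z → x + z) (shift-shift e (m ℕ.* suc j) _ n)))) ⟩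
      rotheTerm v (suc N) u (suc j) n     ∎
    where
      open ≡-Reasoning
      e = rotheExponent v (suc N) u (suc j)
      x = shift e (gaussBinomial N j) n
      y = shift (e ℕ.+ m ℕ.* suc j) (gaussBinomial N (suc j)) n

  -- Rothe's q-binomial theorem: ∏_{i < N} (q^v − q^{u + m i}) = ∑_{j ≤ N} (−1)^j t^{j(j−1)/2} q^{uj + v(N−j)} [N, j]_t
  rotheProduct-expand : ∀ v N u → rotheProduct v N u 1ₛ ≈ ∑ₛ (suc N) (rotheTerm v N u)
  rotheProduct-expand v zero u n =
    sym (trans (ZP.+-identityʳ _) (trans (ZP.*-identityˡ _) (cong (λ e → shift e 1ₛ n) (zero-exponent m u v))))
    where zero-exponent : ∀ m u v → m ℕ.* 0 ℕ.+ u ℕ.* 0 ℕ.+ v ℕ.* 0 ≡ 0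
          zero-exponent = NS.solve-∀
  rotheProduct-expand v (suc N) u n = begin
      monomialDiff v u (rotheProduct v N (u ℕ.+ m) 1ₛ) n
        ≡⟨ LinearShiftInvariant.resp-≈ (monomialDiff-lsi v u) (rotheProduct-expand v N (u ℕ.+ m)) n ⟩
      shift v (∑ₛ (suc N) T) n - shift u (∑ₛ (suc N) T) n
        ≡⟨ cong₂ _-_ (∑ₛ-hom (shift-lsi v) (suc N) T n) (∑ₛ-hom (shift-lsi u) (suc N) T n) ⟩
      ∑ (suc N) (λ j → shift v (T j) n) - ∑ (suc N) (λ j → shift u (T j) n)
        ≡⟨ cong₂ _-_ (rothe-upperSum v N u n) (rothe-lowerSum v N u n) ⟩
      (sign 0 * shift (E 0) 1ₛ n + ∑ (suc N) B) - ∑ (suc N) A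
        ≡⟨ ∑-difference (sign 0 * shift (E 0) 1ₛ n) (suc N) A B ⟩
      sign 0 * shift (E 0) 1ₛ n + ∑ (suc N) (λ j → - A j + B j)
        ≡⟨ cong₂ _+_ (cong (λ x → sign 0 * x) (shift-cong (E 0) (λ k → sym (gaussBinomial-zero (suc N) k)) n))
                     (∑-cong′ (suc N) (rothe-pascal v N u n)) ⟩
      ∑ₛ (suc (suc N)) (rotheTerm v (suc N) u) n
        ∎
    where
      open ≡-Reasoning
      T = rotheTerm v N (u ℕ.+ m)
      E = rotheExponent v (suc N) u
      A = λ j → sign j * shift (E (suc j)) (gaussBinomial N j) n
      B = λ j → - sign j * shift (E (suc j) ℕ.+ m ℕ.* suc j) (gaussBinomial N (suc j)) n

  rotheProduct-≡ : ∀ v N {u u′} f → u ≡ u′ → rotheProduct v N u f ≈ rotheProduct v N u′ f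
  rotheProduct-≡ v N f refl n = refl

  rotheProduct-split : ∀ v a b u f → rotheProduct v (a ℕ.+ b) u f ≈ rotheProduct v a u (rotheProduct v b (u ℕ.+ m ℕ.* a) f)
  rotheProduct-split v zero b u f = rotheProduct-≡ v b f (sym (trans (cong (u ℕ.+_) (NP.*-zeroʳ m)) (NP.+-identityʳ u)))
  rotheProduct-split v (suc a) b u f = LinearShiftInvariant.resp-≈ (monomialDiff-lsi v u) (λ k →
      trans (rotheProduct-split v a b (u ℕ.+ m) f k)
            (LinearShiftInvariant.resp-≈ (rotheProduct-lsi v a (u ℕ.+ m)) (rotheProduct-≡ v b f (regroup m u a)) k))
    where regroup : ∀ m u a → u ℕ.+ m ℕ.+ m ℕ.* a ≡ u ℕ.+ m ℕ.* suc a
          regroup = NS.solve-∀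

  ascending : ℕ → ℕ → List ℕ
  ascending w zero = []
  ascending w (suc N) = w ∷ ascending (w ℕ.+ m) N

  descending : ℕ → ℕ → List ℕ
  descending e zero = []
  descending e (suc N) = (m ℕ.* N ℕ.+ e) ∷ descending e N

  monomialDiff-upper : ∀ v w g → monomialDiff v (v ℕ.+ w) g ≈ shift v (factor w g)
  monomialDiff-upper v w g n = begin
      shift v g n - shift (v ℕ.+ w) g n        ≡⟨ cong (λ x → shift v g n - x) (sym (shift-shift v w g n)) ⟩
      shift v g n - shift v (shift w g) n      ≡⟨ sym (shift-⊖ v g (shift w g) n) ⟩
      shift v (factor w g) n                   ∎
    where open ≡-Reasoning

  monomialDiff-lower : ∀ u w g → monomialDiff (u ℕ.+ w) u g ≈ scale (- 1ℤ) (shift u (factor w g))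
  monomialDiff-lower u w g n = begin
      shift (u ℕ.+ w) g n - shift u g n               ≡⟨ cong (λ x → x - shift u g n) (sym (shift-shift u w g n)) ⟩
      shift u (shift w g) n - shift u g n             ≡⟨ flip-minus (shift u (shift w g) n) (shift u g n) ⟩
      - 1ℤ * (shift u g n - shift u (shift w g) n)    ≡⟨ cong (λ x → - 1ℤ * x) (sym (shift-⊖ u g (shift w g) n)) ⟩
      - 1ℤ * shift u (factor w g) n                   ∎
    where open ≡-Reasoning
          flip-minus : ∀ a b → a - b ≡ - 1ℤ * (b - a)
          flip-minus = solve-∀

  rotheProduct-upper : ∀ v w N g → rotheProduct v N (v ℕ.+ w) g ≈ shift (N ℕ.* v) (factors (ascending w N) g)
  rotheProduct-upper v w zero g n = refl
  rotheProduct-upper v w (suc N) g n = begin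
      monomialDiff v (v ℕ.+ w) X n
        ≡⟨ monomialDiff-upper v w X n ⟩
      shift v (factor w X) n
        ≡⟨ shift-cong v (factor-cong w (λ k → trans (rotheProduct-≡ v N g (NP.+-assoc v w m) k) (rotheProduct-upper v (w ℕ.+ m) N g k))) n ⟩
      shift v (factor w (shift (N ℕ.* v) G)) n
        ≡⟨ shift-cong v (LinearShiftInvariant.shift-hom (factor-lsi w) (N ℕ.* v) G) n ⟩
      shift v (shift (N ℕ.* v) (factor w G)) n
        ≡⟨ shift-shift v (N ℕ.* v) (factor w G) n ⟩
      shift (suc N ℕ.* v) (factor w G) n
        ∎
    where open ≡-Reasoning
          X = rotheProduct v N (v ℕ.+ w ℕ.+ m) g
          G = factors (ascending (w ℕ.+ m) N) g

  rotheProduct-lower : ∀ v e N u h → v ℕ.+ m ≡ u ℕ.+ m ℕ.* N ℕ.+ e →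
    rotheProduct v N u h ≈ scale (sign N) (shift (N ℕ.* u ℕ.+ m ℕ.* triangular N) (factors (descending e N) h))
  rotheProduct-lower v e zero u h _ n = sym (trans (ZP.*-identityˡ _) (cong (λ c → shift c h n) (NP.*-zeroʳ m)))
  rotheProduct-lower v e (suc N) u h v+m≡ n = begin
      monomialDiff v u X n
        ≡⟨ cong (λ a → monomialDiff a u X n) v≡u+w ⟩
      monomialDiff (u ℕ.+ w) u X n
        ≡⟨ monomialDiff-lower u w X n ⟩
      - 1ℤ * shift u (factor w X) n
        ≡⟨ cong (λ x → - 1ℤ * x) (shift-cong u (factor-cong w (rotheProduct-lower v e N (u ℕ.+ m) h v+m≡′)) n) ⟩
      - 1ℤ * shift u (factor w (scale s (shift c G))) n
        ≡⟨ cong (λ x → - 1ℤ * x) (trans (shift-cong u (scale-shift-hom (factor-lsi w) s c G) n) (shift-scale-shift u s c (factor w G) n)) ⟩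
      - 1ℤ * (s * shift (u ℕ.+ c) (factor w G) n)
        ≡⟨ sym (ZP.*-assoc (- 1ℤ) s _) ⟩
      - 1ℤ * s * shift (u ℕ.+ c) (factor w G) n
        ≡⟨ cong₂ (λ s′ a → s′ * shift a (factor w G) n) (ZP.-1*i≡-i s) (exponent m u N (triangular N)) ⟩
      sign (suc N) * shift (suc N ℕ.* u ℕ.+ m ℕ.* triangular (suc N)) (factors (descending e (suc N)) h) n
        ∎
    where
      open ≡-Reasoning
      X = rotheProduct v N (u ℕ.+ m) h
      s = sign N
      c = N ℕ.* (u ℕ.+ m) ℕ.+ m ℕ.* triangular N
      w = m ℕ.* N ℕ.+ e
      G = factors (descending e N) h
      v≡u+w : v ≡ u ℕ.+ w
      v≡u+w = NP.+-cancelʳ-≡ m v (u ℕ.+ w) (trans v+m≡ (regroup m u N e))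
        where regroup : ∀ m u N e → u ℕ.+ m ℕ.* suc N ℕ.+ e ≡ u ℕ.+ (m ℕ.* N ℕ.+ e) ℕ.+ m
              regroup = NS.solve-∀
      v+m≡′ : v ℕ.+ m ≡ u ℕ.+ m ℕ.+ m ℕ.* N ℕ.+ e
      v+m≡′ = trans v+m≡ (regroup m u N e)
        where regroup : ∀ m u N e → u ℕ.+ m ℕ.* suc N ℕ.+ e ≡ u ℕ.+ m ℕ.+ m ℕ.* N ℕ.+ e
              regroup = NS.solve-∀
      exponent : ∀ m u N t → u ℕ.+ (N ℕ.* (u ℕ.+ m) ℕ.+ m ℕ.* t) ≡ suc N ℕ.* u ℕ.+ m ℕ.* (t ℕ.+ N)
      exponent = NS.solve-∀

  polyP polyQ : ℕ → ℕ
  polyP k = m ℕ.* triangular k ℕ.+ k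
  polyQ k = m ℕ.* triangular k ℕ.+ (m ∸ 1) ℕ.* k

  polyP-≥ : ∀ k → k ≤ polyP k
  polyP-≥ k = NP.m≤n+m k (m ℕ.* triangular k)

  polyQ-≥ : ∀ k → k ≤ polyQ k
  polyQ-≥ k = NP.≤-trans k≤[m∸1]k (NP.m≤n+m ((m ∸ 1) ℕ.* k) (m ℕ.* triangular k))
    where k≤[m∸1]k : k ≤ (m ∸ 1) ℕ.* k
          k≤[m∸1]k = subst (λ c → k ≤ c ℕ.* k) (NP.m+[n∸m]≡n (NP.∸-monoˡ-≤ 1 m≥2)) (NP.m≤m+n k _)

  -- exponent of the monomial (−1)^n q^{…} factored out of ∏_{i < 2n} (q^{mn} − q^{1 + m i})
  jacobiShift : ℕ → ℕ
  jacobiShift n = n ℕ.* 1 ℕ.+ m ℕ.* triangular n ℕ.+ n ℕ.* (m ℕ.* n)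

  rotheExponent-upper : ∀ n k → k ≤ n → rotheExponent (m ℕ.* n) (n ℕ.+ n) 1 (n ℕ.+ k) ≡ jacobiShift n ℕ.+ polyP k
  rotheExponent-upper n k k≤n = subst (λ n → rotheExponent (m ℕ.* n) (n ℕ.+ n) 1 (n ℕ.+ k) ≡ jacobiShift n ℕ.+ polyP k)
      (NP.m+[n∸m]≡n k≤n) (at-k+r (n ∸ k))
    where
    at-k+r : ∀ r → rotheExponent (m ℕ.* (k ℕ.+ r)) ((k ℕ.+ r) ℕ.+ (k ℕ.+ r)) 1 ((k ℕ.+ r) ℕ.+ k) ≡ jacobiShift (k ℕ.+ r) ℕ.+ polyP k
    at-k+r r = begin
        m ℕ.* triangular (k ℕ.+ r ℕ.+ k) ℕ.+ 1 ℕ.* (k ℕ.+ r ℕ.+ k) ℕ.+ m ℕ.* (k ℕ.+ r) ℕ.* ((k ℕ.+ r ℕ.+ (k ℕ.+ r)) ∸ (k ℕ.+ r ℕ.+ k))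
          ≡⟨ cong₂ (λ t d → m ℕ.* t ℕ.+ 1 ℕ.* (k ℕ.+ r ℕ.+ k) ℕ.+ m ℕ.* (k ℕ.+ r) ℕ.* d) (triangular-+ (k ℕ.+ r) k)
                   (trans (NP.[m+n]∸[m+o]≡n∸o (k ℕ.+ r) (k ℕ.+ r) k) (NP.m+n∸m≡n k r)) ⟩
        m ℕ.* (triangular (k ℕ.+ r) ℕ.+ triangular k ℕ.+ (k ℕ.+ r) ℕ.* k) ℕ.+ 1 ℕ.* (k ℕ.+ r ℕ.+ k) ℕ.+ m ℕ.* (k ℕ.+ r) ℕ.* r
          ≡⟨ identity m (triangular (k ℕ.+ r)) (triangular k) k r ⟩
        jacobiShift (k ℕ.+ r) ℕ.+ polyP k
          ∎
      where
        open ≡-Reasoning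
        identity : ∀ m tn tk k r →
          m ℕ.* (tn ℕ.+ tk ℕ.+ (k ℕ.+ r) ℕ.* k) ℕ.+ 1 ℕ.* ((k ℕ.+ r) ℕ.+ k) ℕ.+ m ℕ.* (k ℕ.+ r) ℕ.* r ≡
          (k ℕ.+ r) ℕ.* 1 ℕ.+ m ℕ.* tn ℕ.+ (k ℕ.+ r) ℕ.* (m ℕ.* (k ℕ.+ r)) ℕ.+ (m ℕ.* tk ℕ.+ k)
        identity = NS.solve-∀

  rotheExponent-lower : ∀ n l → l < n → rotheExponent (m ℕ.* n) (n ℕ.+ n) 1 (n ∸ suc l) ≡ jacobiShift n ℕ.+ polyQ (suc l)
  rotheExponent-lower n l l<n = subst (λ n → rotheExponent (m ℕ.* n) (n ℕ.+ n) 1 (n ∸ suc l) ≡ jacobiShift n ℕ.+ polyQ (suc l))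
      (NP.m+[n∸m]≡n l<n)
      (trans (cong (rotheExponent (m ℕ.* (suc l ℕ.+ r)) ((suc l ℕ.+ r) ℕ.+ (suc l ℕ.+ r)) 1) (NP.m+n∸m≡n (suc l) r)) (at-r r))
    where
    r = n ∸ suc l
    m′ = m ∸ 1
    at-r : ∀ r → rotheExponent (m ℕ.* (suc l ℕ.+ r)) ((suc l ℕ.+ r) ℕ.+ (suc l ℕ.+ r)) 1 r ≡ jacobiShift (suc l ℕ.+ r) ℕ.+ polyQ (suc l)
    at-r r = begin
        m ℕ.* triangular r ℕ.+ 1 ℕ.* r ℕ.+ m ℕ.* n′ ℕ.* ((n′ ℕ.+ n′) ∸ r)
          ≡⟨ cong (λ d → m ℕ.* triangular r ℕ.+ 1 ℕ.* r ℕ.+ m ℕ.* n′ ℕ.* d) (trans (cong (_∸ r) (regroup l r)) (NP.m+n∸n≡m (n′ ℕ.+ suc l) r)) ⟩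
        m ℕ.* triangular r ℕ.+ 1 ℕ.* r ℕ.+ m ℕ.* n′ ℕ.* (n′ ℕ.+ suc l)
          ≡⟨ cong (λ c → c ℕ.* triangular r ℕ.+ 1 ℕ.* r ℕ.+ c ℕ.* n′ ℕ.* (n′ ℕ.+ suc l)) m≡1+[m∸1] ⟩
        suc m′ ℕ.* triangular r ℕ.+ 1 ℕ.* r ℕ.+ suc m′ ℕ.* n′ ℕ.* (n′ ℕ.+ suc l)
          ≡⟨ expand m′ l r (triangular r) ⟩
        X ℕ.+ suc m′ ℕ.* (l ℕ.* suc l)
          ≡⟨ cong (λ t → X ℕ.+ suc m′ ℕ.* t) (sym (triangular-double l)) ⟩
        X ℕ.+ suc m′ ℕ.* (triangular (suc l) ℕ.+ triangular (suc l))
          ≡⟨ collect m′ l r (triangular r) (triangular (suc l)) ⟩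
        n′ ℕ.* 1 ℕ.+ suc m′ ℕ.* (triangular (suc l) ℕ.+ triangular r ℕ.+ suc l ℕ.* r) ℕ.+ n′ ℕ.* (suc m′ ℕ.* n′)
          ℕ.+ (suc m′ ℕ.* triangular (suc l) ℕ.+ m′ ℕ.* suc l)
          ≡⟨ cong₂ (λ c t → n′ ℕ.* 1 ℕ.+ c ℕ.* t ℕ.+ n′ ℕ.* (c ℕ.* n′) ℕ.+ (c ℕ.* triangular (suc l) ℕ.+ m′ ℕ.* suc l))
                   (sym m≡1+[m∸1]) (sym (triangular-+ (suc l) r)) ⟩
        jacobiShift n′ ℕ.+ polyQ (suc l)
          ∎
      where
        open ≡-Reasoning
        n′ = suc l ℕ.+ r
        X = suc l ℕ.+ r ℕ.+ suc m′ ℕ.* triangular r ℕ.+ suc m′ ℕ.* suc l ℕ.* r ℕ.+ suc m′ ℕ.* (suc l ℕ.+ r) ℕ.* (suc l ℕ.+ r) ℕ.+ m′ ℕ.* suc l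
        regroup : ∀ l r → (suc l ℕ.+ r) ℕ.+ (suc l ℕ.+ r) ≡ (suc l ℕ.+ r) ℕ.+ suc l ℕ.+ r
        regroup = NS.solve-∀
        expand : ∀ m′ l r tr → suc m′ ℕ.* tr ℕ.+ 1 ℕ.* r ℕ.+ suc m′ ℕ.* (suc l ℕ.+ r) ℕ.* ((suc l ℕ.+ r) ℕ.+ suc l) ≡
          (suc l ℕ.+ r ℕ.+ suc m′ ℕ.* tr ℕ.+ suc m′ ℕ.* suc l ℕ.* r ℕ.+ suc m′ ℕ.* (suc l ℕ.+ r) ℕ.* (suc l ℕ.+ r) ℕ.+ m′ ℕ.* suc l)
          ℕ.+ suc m′ ℕ.* (l ℕ.* suc l)
        expand = NS.solve-∀
        collect : ∀ m′ l r tr ts →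
          (suc l ℕ.+ r ℕ.+ suc m′ ℕ.* tr ℕ.+ suc m′ ℕ.* suc l ℕ.* r ℕ.+ suc m′ ℕ.* (suc l ℕ.+ r) ℕ.* (suc l ℕ.+ r) ℕ.+ m′ ℕ.* suc l)
          ℕ.+ suc m′ ℕ.* (ts ℕ.+ ts) ≡
          (suc l ℕ.+ r) ℕ.* 1 ℕ.+ suc m′ ℕ.* (ts ℕ.+ tr ℕ.+ suc l ℕ.* r) ℕ.+ (suc l ℕ.+ r) ℕ.* (suc m′ ℕ.* (suc l ℕ.+ r))
          ℕ.+ (suc m′ ℕ.* ts ℕ.+ m′ ℕ.* suc l)
        collect = NS.solve-∀

  -- the finite triple product (t; t)_n ∏_{k=1}^{n} (1 − t^{k} q^{−1}) ∏_{k=0}^{n−1} (1 − t^{k} q)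
  tripleBlock : ℕ → Series
  tripleBlock n = factors (tPowers 0 n) (factors (descending (m ∸ 1) n) (factors (ascending 1 n) 1ₛ))

  reducedBinomial : ℕ → ℕ → Series
  reducedBinomial n j = factors (tPowers 0 n) (gaussBinomial (n ℕ.+ n) j)

  rotheProduct-jacobi : ∀ n → rotheProduct (m ℕ.* n) (n ℕ.+ n) 1 1ₛ ≈
    scale (sign n) (shift (jacobiShift n) (factors (descending (m ∸ 1) n) (factors (ascending 1 n) 1ₛ)))
  rotheProduct-jacobi n x = begin
      rotheProduct v (n ℕ.+ n) 1 1ₛ x
        ≡⟨ rotheProduct-split v n n 1 1ₛ x ⟩
      rotheProduct v n 1 (rotheProduct v n (1 ℕ.+ m ℕ.* n) 1ₛ) x
        ≡⟨ LinearShiftInvariant.resp-≈ (rotheProduct-lsi v n 1)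
             (λ k → trans (rotheProduct-≡ v n 1ₛ (NP.+-comm 1 v) k) (rotheProduct-upper v 1 n 1ₛ k)) x ⟩
      rotheProduct v n 1 (shift (n ℕ.* v) PP) x
        ≡⟨ rotheProduct-lower v (m ∸ 1) n 1 (shift (n ℕ.* v) PP) v+m≡ x ⟩
      sign n * shift (n ℕ.* 1 ℕ.+ m ℕ.* triangular n) (factors PD (shift (n ℕ.* v) PP)) x
        ≡⟨ cong (λ x → sign n * x) (trans (shift-cong (n ℕ.* 1 ℕ.+ m ℕ.* triangular n) (LinearShiftInvariant.shift-hom (factors-lsi PD) (n ℕ.* v) PP) x)
                                   (shift-shift (n ℕ.* 1 ℕ.+ m ℕ.* triangular n) (n ℕ.* v) (factors PD PP) x)) ⟩
      sign n * shift (jacobiShift n) (factors PD PP) x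
        ∎
    where
      open ≡-Reasoning
      v = m ℕ.* n
      PD = descending (m ∸ 1) n
      PP = factors (ascending 1 n) 1ₛ
      v+m≡ : v ℕ.+ m ≡ 1 ℕ.+ m ℕ.* n ℕ.+ (m ∸ 1)
      v+m≡ = subst (λ c → c ℕ.* n ℕ.+ c ≡ 1 ℕ.+ c ℕ.* n ℕ.+ (m ∸ 1)) (sym m≡1+[m∸1]) (regroup (m ∸ 1) n)
        where regroup : ∀ m′ n → suc m′ ℕ.* n ℕ.+ suc m′ ≡ 1 ℕ.+ suc m′ ℕ.* n ℕ.+ m′
              regroup = NS.solve-∀

  tripleBlock-expand : ∀ n x → sign n * shift (jacobiShift n) (tripleBlock n) x ≡
    ∑ (suc (n ℕ.+ n)) (λ j → sign j * shift (rotheExponent (m ℕ.* n) (n ℕ.+ n) 1 j) (reducedBinomial n j) x)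
  tripleBlock-expand n x = begin
      sign n * shift (jacobiShift n) (factors R PDP) x
        ≡⟨ sym (scale-shift-hom (factors-lsi R) (sign n) (jacobiShift n) PDP x) ⟩
      factors R (scale (sign n) (shift (jacobiShift n) PDP)) x
        ≡⟨ factors-cong R (λ k → sym (rotheProduct-jacobi n k)) x ⟩
      factors R (rotheProduct (m ℕ.* n) (n ℕ.+ n) 1 1ₛ) x
        ≡⟨ factors-cong R (rotheProduct-expand (m ℕ.* n) (n ℕ.+ n) 1) x ⟩
      factors R (∑ₛ (suc (n ℕ.+ n)) (rotheTerm (m ℕ.* n) (n ℕ.+ n) 1)) x
        ≡⟨ ∑ₛ-hom (factors-lsi R) (suc (n ℕ.+ n)) (rotheTerm (m ℕ.* n) (n ℕ.+ n) 1) x ⟩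
      ∑ (suc (n ℕ.+ n)) (λ j → factors R (rotheTerm (m ℕ.* n) (n ℕ.+ n) 1 j) x)
        ≡⟨ ∑-cong′ (suc (n ℕ.+ n)) (λ j →
             scale-shift-hom (factors-lsi R) (sign j) (rotheExponent (m ℕ.* n) (n ℕ.+ n) 1 j) (gaussBinomial (n ℕ.+ n) j) x) ⟩
      ∑ (suc (n ℕ.+ n)) (λ j → sign j * shift (rotheExponent (m ℕ.* n) (n ℕ.+ n) 1 j) (reducedBinomial n j) x)
        ∎
    where open ≡-Reasoning
          R = tPowers 0 n
          PDP = factors (descending (m ∸ 1) n) (factors (ascending 1 n) 1ₛ)

  -- the terms j = n + k and j = n − 1 − l of the Rothe expansion carry q^{P_k} and q^{Q_{l+1}}
  tripleBlock-split : ∀ n i → tripleBlock n i ≡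
    ∑ (suc n) (λ k → sign k * shift (polyP k) (reducedBinomial n (n ℕ.+ k)) i) +
    ∑ n (λ l → sign (suc l) * shift (polyQ (suc l)) (reducedBinomial n (n ∸ suc l)) i)
  tripleBlock-split n i = sign-cancel n (begin
      sign n * tripleBlock n i
        ≡⟨ cong (λ x → sign n * x) (sym (shift-+ (jacobiShift n) (tripleBlock n) i)) ⟩
      sign n * shift (jacobiShift n) (tripleBlock n) (jacobiShift n ℕ.+ i)
        ≡⟨ tripleBlock-expand n (jacobiShift n ℕ.+ i) ⟩
      ∑ (suc (n ℕ.+ n)) h
        ≡⟨ cong (λ c → ∑ c h) (sym (NP.+-suc n n)) ⟩
      ∑ (n ℕ.+ suc n) h
        ≡⟨ ∑-split n (suc n) h ⟩
      ∑ n h + ∑ (suc n) (λ k → h (n ℕ.+ k))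
        ≡⟨ cong₂ _+_ (trans (∑-reverse n h) (trans (∑-cong n lower) (∑-* n (sign n) B)))
                     (trans (∑-cong (suc n) (λ k k<1+n → upper k (NP.≤-pred k<1+n))) (∑-* (suc n) (sign n) A)) ⟩
      sign n * ∑ n B + sign n * ∑ (suc n) A
        ≡⟨ trans (ZP.+-comm (sign n * ∑ n B) (sign n * ∑ (suc n) A)) (sym (ZP.*-distribˡ-+ (sign n) (∑ (suc n) A) (∑ n B))) ⟩
      sign n * (∑ (suc n) A + ∑ n B)
        ∎)
    where
      open ≡-Reasoning
      h = λ j → sign j * shift (rotheExponent (m ℕ.* n) (n ℕ.+ n) 1 j) (reducedBinomial n j) (jacobiShift n ℕ.+ i)
      A = λ k → sign k * shift (polyP k) (reducedBinomial n (n ℕ.+ k)) i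
      B = λ l → sign (suc l) * shift (polyQ (suc l)) (reducedBinomial n (n ∸ suc l)) i
      upper : ∀ k → k ≤ n → h (n ℕ.+ k) ≡ sign n * A k
      upper k k≤n = trans
        (cong₂ (λ s e → s * shift e (reducedBinomial n (n ℕ.+ k)) (jacobiShift n ℕ.+ i)) (sign-+ n k) (rotheExponent-upper n k k≤n))
        (trans (cong (λ x → sign n * sign k * x) (shift-cancel (jacobiShift n) (polyP k) (reducedBinomial n (n ℕ.+ k)) i))
               (ZP.*-assoc (sign n) (sign k) _))
      lower : ∀ l → l < n → h (n ∸ suc l) ≡ sign n * B l
      lower l l<n = trans
        (cong₂ (λ s e → s * shift e (reducedBinomial n (n ∸ suc l)) (jacobiShift n ℕ.+ i)) (sign-∸ n l l<n) (rotheExponent-lower n l l<n))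
        (trans (cong (λ x → sign n * sign (suc l) * x) (shift-cancel (jacobiShift n) (polyQ (suc l)) (reducedBinomial n (n ∸ suc l)) i))
               (ZP.*-assoc (sign n) (sign (suc l)) _))

  N≤2N∸ : ∀ {N k} → k ≤ N → N ≤ N ℕ.+ N ∸ k
  N≤2N∸ {N} k≤N = NP.≤-trans (NP.≤-reflexive (sym (NP.m+n∸n≡m N N))) (NP.∸-monoʳ-≤ (N ℕ.+ N) k≤N)

  factors-tPowers-≈-beyond : ∀ b c g M → M ≤ b → factors (tPowers b c) g ≈[ M ] g
  factors-tPowers-≈-beyond b zero g M M≤b n p = refl
  factors-tPowers-≈-beyond b (suc c) g M M≤b =
    ≈[]-trans (factor-≈-beyond (m ℕ.* (b ℕ.+ suc c)) (factors (tPowers b c) g) M M<exponent) (factors-tPowers-≈-beyond b c g M M≤b)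
    where x≤mx : ∀ x → x ≤ m ℕ.* x
          x≤mx x = subst (λ c → x ≤ c ℕ.* x) (sym m≡1+[m∸1]) (NP.m≤m+n x _)
          M<exponent : M < m ℕ.* (b ℕ.+ suc c)
          M<exponent = NP.<-≤-trans (s≤s (NP.≤-trans M≤b (NP.m≤m+n b c)))
                                   (NP.≤-trans (NP.≤-reflexive (sym (NP.+-suc b c))) (x≤mx (b ℕ.+ suc c)))

  -- (t; t)_n [2n, n+k]_t = (t^{n−k+1}; t)_{n+k} / (t^{n+1}; t)_k, which is 1 below degree n − k + 1
  reducedBinomial-upper≈1 : ∀ n k → k ≤ n → reducedBinomial n (n ℕ.+ k) ≈[ n ∸ k ] 1ₛ
  reducedBinomial-upper≈1 n k k≤n = ≈[]-trans (≈[]-sym (factors-tPowers-≈-beyond n k X (n ∸ k) (NP.m∸n≤m n k)))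
      (≈[]-trans (≈⇒≈[] (n ∸ k) completed) (factors-tPowers-≈-beyond (n ∸ k) (n ℕ.+ k) 1ₛ (n ∸ k) NP.≤-refl))
    where
      X = reducedBinomial n (n ℕ.+ k)
      n+n≡ : n ℕ.+ n ≡ n ℕ.+ k ℕ.+ (n ∸ k)
      n+n≡ = trans (cong (n ℕ.+_) (sym (NP.m+[n∸m]≡n k≤n))) (sym (NP.+-assoc n k (n ∸ k)))
      completed : factors (tPowers n k) X ≈ factors (tPowers (n ∸ k) (n ℕ.+ k)) 1ₛ
      completed x = trans (sym (cong (λ g → g x) (factors-tPowers-split 0 n k _)))
        (trans (factors-cong (tPowers 0 (n ℕ.+ k)) (gaussBinomial-≡ (n ℕ.+ k) n+n≡) x) (factors-gaussBinomial (n ℕ.+ k) (n ∸ k) x))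

  reducedBinomial-lower≈1 : ∀ n l → l < n → reducedBinomial n (n ∸ suc l) ≈[ n ∸ suc l ] 1ₛ
  reducedBinomial-lower≈1 n l l<n x p = begin
      factors (tPowers 0 n) Y x
        ≡⟨ cong (λ c → factors (tPowers 0 c) Y x) (sym r+l+1≡n) ⟩
      factors (tPowers 0 (r ℕ.+ suc l)) Y x
        ≡⟨ cong (λ g → g x) (factors-tPowers-split 0 r (suc l) Y) ⟩
      factors (tPowers r (suc l)) (factors (tPowers 0 r) Y) x
        ≡⟨ ≈[]-trans (factors-resp (tPowers r (suc l)) r head≈1) (factors-tPowers-≈-beyond r (suc l) 1ₛ r NP.≤-refl) x p ⟩
      1ₛ x
        ∎
    where
      open ≡-Reasoning
      r = n ∸ suc l
      b = n ℕ.+ suc l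
      Y = gaussBinomial (n ℕ.+ n) r
      r+l+1≡n : r ℕ.+ suc l ≡ n
      r+l+1≡n = NP.m∸n+n≡m l<n
      n+n≡r+b : n ℕ.+ n ≡ r ℕ.+ b
      n+n≡r+b = trans (cong (ℕ._+ n) (sym r+l+1≡n)) (trans (NP.+-assoc r (suc l) n) (cong (r ℕ.+_) (NP.+-comm (suc l) n)))
      head≈1 : factors (tPowers 0 r) Y ≈[ r ] 1ₛ
      head≈1 = ≈[]-trans (≈⇒≈[] r (λ x → trans (factors-cong (tPowers 0 r) (gaussBinomial-≡ r n+n≡r+b) x) (factors-gaussBinomial r b x)))
                         (factors-tPowers-≈-beyond b r 1ₛ r (NP.≤-trans (NP.m∸n≤m n (suc l)) (NP.m≤m+n n (suc l))))

  -- multiplication by 1 + ∑_{k < K} (−1)^{k+1} (q^{P_{k+1}} + q^{Q_{k+1}})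
  theta : ℕ → Series → Series
  theta K f = f ⊕ ∑ₛ K (λ k → scale (sign (suc k)) (shift (polyP (suc k)) f ⊕ shift (polyQ (suc k)) f))

  theta-resp : ∀ K {f g} N → f ≈[ N ] g → theta K f ≈[ N ] theta K g
  theta-resp K N e i p = cong₂ _+_ (e i p) (∑-cong′ K (λ k → cong (λ x → sign (suc k) * x)
    (cong₂ _+_ (shift-resp (polyP (suc k)) N e i p) (shift-resp (polyQ (suc k)) N e i p))))

  theta-comm : ∀ K {O} → LinearShiftInvariant O → ∀ f → theta K (O f) ≈ O (theta K f)
  theta-comm K {O} lsi f i = sym (begin
      O (theta K f) i
        ≡⟨ ⊕-hom f _ i ⟩
      O f i + O (∑ₛ K H) i
        ≡⟨ cong (λ x → O f i + x) (∑ₛ-hom lsi K H i) ⟩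
      O f i + ∑ K (λ k → O (H k) i)
        ≡⟨ cong (λ x → O f i + x) (∑-cong′ K (λ k → trans (scale-hom (sign (suc k)) _ i) (cong (λ x → sign (suc k) * x)
             (trans (⊕-hom (shift (polyP (suc k)) f) (shift (polyQ (suc k)) f) i)
                    (cong₂ _+_ (shift-hom (polyP (suc k)) f i) (shift-hom (polyQ (suc k)) f i)))))) ⟩
      theta K (O f) i
        ∎)
    where
      open ≡-Reasoning
      open LinearShiftInvariant lsi
      H = λ k → scale (sign (suc k)) (shift (polyP (suc k)) f ⊕ shift (polyQ (suc k)) f)

  -- a factor q^{P_k} or q^{Q_k} with k > N is invisible below degree N + 1
  tripleBlock-upperTerm : ∀ N k → k ≤ N ℕ.+ N → shift (polyP k) (reducedBinomial (N ℕ.+ N) (N ℕ.+ N ℕ.+ k)) ≈[ N ] shift (polyP k) 1ₛ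
  tripleBlock-upperTerm N k k≤2N with k ℕ.≤? N
  ... | yes k≤N = shift-resp (polyP k) N (≈[]-mono (N≤2N∸ k≤N) (reducedBinomial-upper≈1 (N ℕ.+ N) k k≤2N))
  ... | no k≰N = shift-≈-beyond (polyP k) _ _ N (NP.<-≤-trans (NP.≰⇒> k≰N) (polyP-≥ k))

  tripleBlock-lowerTerm : ∀ N l → l < N ℕ.+ N →
    shift (polyQ (suc l)) (reducedBinomial (N ℕ.+ N) (N ℕ.+ N ∸ suc l)) ≈[ N ] shift (polyQ (suc l)) 1ₛ
  tripleBlock-lowerTerm N l l<2N with suc l ℕ.≤? N
  ... | yes l<N = shift-resp (polyQ (suc l)) N (≈[]-mono (N≤2N∸ l<N) (reducedBinomial-lower≈1 (N ℕ.+ N) l l<2N))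
  ... | no l≮N = shift-≈-beyond (polyQ (suc l)) _ _ N (NP.<-≤-trans (NP.≰⇒> l≮N) (polyQ-≥ (suc l)))

  tripleBlock≈theta : ∀ N → tripleBlock (N ℕ.+ N) ≈[ N ] theta (N ℕ.+ N) 1ₛ
  tripleBlock≈theta N i p = begin
      tripleBlock n i
        ≡⟨ tripleBlock-split n i ⟩
      ∑ (suc n) (λ k → sign k * shift (polyP k) (reducedBinomial n (n ℕ.+ k)) i) +
      ∑ n (λ l → sign (suc l) * shift (polyQ (suc l)) (reducedBinomial n (n ∸ suc l)) i)
        ≡⟨ cong₂ _+_ (∑-cong (suc n) (λ k k<1+n → cong (λ x → sign k * x) (tripleBlock-upperTerm N k (NP.≤-pred k<1+n) i p)))
                     (∑-cong n (λ l l<n → cong (λ x → sign (suc l) * x) (tripleBlock-lowerTerm N l l<n i p))) ⟩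
      (sign 0 * shift (polyP 0) 1ₛ i + ∑ n a) + ∑ n b
        ≡⟨ cong (λ x → (x + ∑ n a) + ∑ n b) (trans (ZP.*-identityˡ _) (cong (λ e → shift e 1ₛ i) (trans (NP.+-identityʳ _) (NP.*-zeroʳ m)))) ⟩
      (1ₛ i + ∑ n a) + ∑ n b
        ≡⟨ ZP.+-assoc (1ₛ i) (∑ n a) (∑ n b) ⟩
      1ₛ i + (∑ n a + ∑ n b)
        ≡⟨ cong (λ x → 1ₛ i + x) (trans (sym (∑-+ n a b)) (∑-cong′ n (λ k → sym (ZP.*-distribˡ-+ (sign (suc k)) _ _)))) ⟩
      theta n 1ₛ i
        ∎
    where
      open ≡-Reasoning
      n = N ℕ.+ N
      a = λ k → sign (suc k) * shift (polyP (suc k)) 1ₛ i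
      b = λ l → sign (suc l) * shift (polyQ (suc l)) 1ₛ i

module Reordering (m : ℕ) (m≥3 : 3 ≤ m) where

  open import Data.Nat using (zero; suc; _∸_; z≤n; s≤s; _<_; _+_; _*_)
  import Data.Nat.Properties as NP
  import Data.Nat.Tactic.RingSolver as NS
  open import Data.Nat.Divisibility using (_∣_; ∣m+n∣m⇒∣n; ∣m∣n⇒∣m+n; ∣-refl; ∣⇒≤; m∣m*n)
  open import Data.List using (_∷_)
  open import Data.Sum using (inj₁; inj₂)
  open import Relation.Nullary using (Dec; yes; no; ¬_)
  open import Relation.Binary.PropositionalEquality
  open import Data.Empty using (⊥-elim)
  open import Defs
  open PowerSeries
  open PartitionSeries m
  open TripleProduct m (NP.≤-trans (s≤s (s≤s z≤n)) m≥3) using (tPowers; descending; ascending)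

  p : ℕ
  p = m ∸ 3

  m≡3+p : m ≡ 3 + p
  m≡3+p = sym (NP.m+[n∸m]≡n m≥3)

  consIf-yes : ∀ {P : Set} (d : Dec P) {x xs} → P → consIf d x xs ≡ x ∷ xs
  consIf-yes (yes _) _ = refl
  consIf-yes (no ¬P) P = ⊥-elim (¬P P)

  consIf-no : ∀ {P : Set} (d : Dec P) {x xs} → ¬ P → consIf d x xs ≡ xs
  consIf-no (yes P) ¬P = ⊥-elim (¬P P)
  consIf-no (no _) _ = refl

  allowedUpTo-allowed : ∀ b → Allowed m (suc b) → allowedUpTo (suc b) ≡ suc b ∷ allowedUpTo b
  allowedUpTo-allowed b = consIf-yes (allowed? m (suc b))

  allowedUpTo-skip : ∀ b → ¬ Allowed m (suc b) → allowedUpTo (suc b) ≡ allowedUpTo b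
  allowedUpTo-skip b = consIf-no (allowed? m (suc b))

  ascending-last : ∀ w N f → factors (ascending w (suc N)) f ≈ factors (ascending w N) (factor (w + m * N) f)
  ascending-last w zero f n = cong (λ e → factor e f n) (sym (trans (cong (w +_) (NP.*-zeroʳ m)) (NP.+-identityʳ w)))
  ascending-last w (suc N) f n = factor-cong w (λ k → trans (ascending-last (w + m) N f k)
      (cong (λ e → factors (ascending (w + m) N) (factor e f) k) (regroup m w N))) n
    where regroup : ∀ m w N → w + m + m * N ≡ w + m * suc N
          regroup = NS.solve-∀

  ∤-between : ∀ n r → 0 < r → r < m → ¬ (m ∣ m * n + r)
  ∤-between n (suc r) _ r<m m∣ = NP.<⇒≱ r<m (∣⇒≤ (∣m+n∣m⇒∣n m∣ (m∣m*n n)))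

  gap-notAllowed : ∀ n s → s < p → ¬ Allowed m (suc (m * n + 1 + s))
  gap-notAllowed n s s<p (inj₁ m∣) = ∤-between n (2 + s) (s≤s z≤n)
      (subst (2 + s <_) (sym m≡3+p) (s≤s (s≤s (s≤s (NP.<⇒≤ s<p))))) (subst (m ∣_) (regroup (m * n) s) m∣)
    where regroup : ∀ b s → suc (b + 1 + s) ≡ b + (2 + s)
          regroup = NS.solve-∀
  gap-notAllowed n s s<p (inj₂ (inj₁ m∣)) = ∤-between n (1 + s) (s≤s z≤n)
      (subst (1 + s <_) (sym m≡3+p) (s≤s (NP.m≤n⇒m≤1+n (s≤s (NP.<⇒≤ s<p))))) (subst (m ∣_) (regroup (m * n) s) m∣)
    where regroup : ∀ b s → b + 1 + s ≡ b + (1 + s)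
          regroup = NS.solve-∀
  gap-notAllowed n s s<p (inj₂ (inj₂ m∣)) = ∤-between n (3 + s) (s≤s z≤n)
      (subst (3 + s <_) (sym m≡3+p) (s≤s (s≤s (s≤s s<p)))) (subst (m ∣_) (regroup (m * n) s) m∣)
    where regroup : ∀ b s → suc (b + 1 + s) + 1 ≡ b + (3 + s)
          regroup = NS.solve-∀

  allowedUpTo-gap : ∀ n s → s ≤ p → allowedUpTo (m * n + 1 + s) ≡ allowedUpTo (m * n + 1)
  allowedUpTo-gap n zero _ = cong allowedUpTo (NP.+-identityʳ (m * n + 1))
  allowedUpTo-gap n (suc s) s<p = trans (cong allowedUpTo (NP.+-suc (m * n + 1) s))
    (trans (allowedUpTo-skip (m * n + 1 + s) (gap-notAllowed n s s<p)) (allowedUpTo-gap n s (NP.≤-trans (NP.n≤1+n s) s<p)))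

  allowedUpTo-block : ∀ n → allowedUpTo (m * suc n) ≡ m * suc n ∷ (m * n + (m ∸ 1)) ∷ (1 + m * n) ∷ allowedUpTo (m * n)
  allowedUpTo-block n = begin
      allowedUpTo (m * suc n)
        ≡⟨ cong allowedUpTo m[n+1]≡ ⟩
      allowedUpTo (suc (suc (b + 1 + p)))
        ≡⟨ allowedUpTo-allowed (suc (b + 1 + p)) top-allowed ⟩
      suc (suc (b + 1 + p)) ∷ allowedUpTo (suc (b + 1 + p))
        ≡⟨ cong (suc (suc (b + 1 + p)) ∷_) (allowedUpTo-allowed (b + 1 + p) below-top-allowed) ⟩
      suc (suc (b + 1 + p)) ∷ suc (b + 1 + p) ∷ allowedUpTo (b + 1 + p)
        ≡⟨ cong (λ xs → suc (suc (b + 1 + p)) ∷ suc (b + 1 + p) ∷ xs)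
             (trans (allowedUpTo-gap n p NP.≤-refl) (trans (cong allowedUpTo (NP.+-comm b 1)) (allowedUpTo-allowed b bottom-allowed))) ⟩
      suc (suc (b + 1 + p)) ∷ suc (b + 1 + p) ∷ suc b ∷ allowedUpTo b
        ≡⟨ cong₂ _∷_ (sym m[n+1]≡) (cong₂ _∷_ below-top≡ refl) ⟩
      m * suc n ∷ (m * n + (m ∸ 1)) ∷ (1 + m * n) ∷ allowedUpTo (m * n)
        ∎
    where
      open ≡-Reasoning
      b = m * n
      m[n+1]≡ : m * suc n ≡ suc (suc (b + 1 + p))
      m[n+1]≡ = trans (NP.*-suc m n) (trans (cong (_+ b) m≡3+p) (regroup b p))
        where regroup : ∀ b p → 3 + p + b ≡ suc (suc (b + 1 + p))
              regroup = NS.solve-∀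
      below-top≡ : suc (b + 1 + p) ≡ b + (m ∸ 1)
      below-top≡ = trans (regroup b p) (cong (λ c → b + (c ∸ 1)) (sym m≡3+p))
        where regroup : ∀ b p → suc (b + 1 + p) ≡ b + (2 + p)
              regroup = NS.solve-∀
      m∣m[n+1] : m ∣ m * suc n
      m∣m[n+1] = subst (m ∣_) (trans (NP.+-comm (m * n) m) (sym (NP.*-suc m n))) (∣m∣n⇒∣m+n (m∣m*n n) ∣-refl)
      top-allowed : Allowed m (suc (suc (b + 1 + p)))
      top-allowed = inj₁ (subst (m ∣_) m[n+1]≡ m∣m[n+1])
      below-top-allowed : Allowed m (suc (b + 1 + p))
      below-top-allowed = inj₂ (inj₂ (subst (m ∣_) (trans m[n+1]≡ (NP.+-comm 1 _)) m∣m[n+1]))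
      bottom-allowed : Allowed m (suc b)
      bottom-allowed = inj₂ (inj₁ (m∣m*n n))

  factors-allowedUpTo-reorder : ∀ n f → factors (allowedUpTo (m * n)) f ≈
    factors (tPowers 0 n) (factors (descending (m ∸ 1) n) (factors (ascending 1 n) f))
  factors-allowedUpTo-reorder zero f k = cong (λ c → factors (allowedUpTo c) f k) (NP.*-zeroʳ m)
  factors-allowedUpTo-reorder (suc n) f k = begin
      factors (allowedUpTo (m * suc n)) f k
        ≡⟨ cong (λ ds → factors ds f k) (allowedUpTo-block n) ⟩
      factor x (factor y (factor z (factors (allowedUpTo (m * n)) f))) k
        ≡⟨ factor-cong x (factor-cong y (factor-cong z (factors-allowedUpTo-reorder n f))) k ⟩
      factor x (factor y (factor z (factors R (factors PD (factors PA f))))) k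
        ≡⟨ factor-cong x (λ j → sym (trans (factors-factor R y _ j) (factor-cong y (factors-factor R z (factors PD (factors PA f))) j))) k ⟩
      factor x (factors R (factor y (factor z (factors PD (factors PA f))))) k
        ≡⟨ factor-cong x (factors-cong R (factor-cong y (λ j →
             sym (trans (factors-cong PD (factors-factor PA z f) j) (factors-factor PD z (factors PA f) j))))) k ⟩
      factor x (factors R (factor y (factors PD (factors PA (factor z f))))) k
        ≡⟨ factor-cong x (factors-cong R (factor-cong y (factors-cong PD (λ i → sym (ascending-last 1 n f i))))) k ⟩
      factors (tPowers 0 (suc n)) (factors (descending (m ∸ 1) (suc n)) (factors (ascending 1 (suc n)) f)) k
        ∎
    where
      open ≡-Reasoning
      x = m * suc n
      y = m * n + (m ∸ 1)
      z = 1 + m * n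
      R = tPowers 0 n
      PD = descending (m ∸ 1) n
      PA = ascending 1 n

module Identity (m : ℕ) (m≥3 : 3 ≤ m) where

  open import Data.Nat as ℕ using (zero; suc; _∸_; z≤n; s≤s; _<_)
  import Data.Nat.Properties as NP
  import Data.Nat.Tactic.RingSolver as NS
  open import Data.Nat.DivMod using (_/_; m*n/n≡m)
  open import Data.Integer as ℤ using (ℤ; +_; 0ℤ; -1ℤ; _+_; _*_; -_; _-_)
  import Data.Integer.Properties as ZP
  open import Data.Integer.Tactic.RingSolver
  open import Relation.Binary.PropositionalEquality
  open import Function using (_∘_)
  open import Relation.Nullary using (yes; no)
  open import Defs
  open PowerSeries
  open PartitionSeries m
  open TripleProduct m (NP.≤-trans (s≤s (s≤s z≤n)) m≥3)
  open Reordering m m≥3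

  -- 1/F = Θ modulo q^{N+1}: cancel the allowed factors (1 − q^d), d ≤ m(N + N), against the triple product
  theta-partitionSeries : ∀ N → theta (N ℕ.+ N) partitionSeries ≈[ N ] 1ₛ
  theta-partitionSeries N = factors-injective A N (allowedUpTo-positive (m ℕ.* n)) (λ i i≤N → begin
      factors A (theta n partitionSeries) i       ≡⟨ sym (theta-comm n (factors-lsi A) partitionSeries i) ⟩
      theta n (factors A partitionSeries) i       ≡⟨ theta-resp n N A·F≈1 i i≤N ⟩
      theta n 1ₛ i                                ≡⟨ sym (tripleBlock≈theta N i i≤N) ⟩
      tripleBlock n i                             ≡⟨ sym (factors-allowedUpTo-reorder n 1ₛ i) ⟩
      factors A 1ₛ i                              ∎)
    where
      open ≡-Reasoning
      n = N ℕ.+ N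
      A = allowedUpTo (m ℕ.* n)
      N≤mn : N ≤ m ℕ.* n
      N≤mn = NP.≤-trans (NP.m≤m+n N N) (subst (λ c → n ≤ c ℕ.* n) (NP.m+[n∸m]≡n m≥1) (NP.m≤m+n n _))
      A·F≈1 : factors A partitionSeries ≈[ N ] 1ₛ
      A·F≈1 i i≤N = trans (factors-resp A N (partitionSeries≈boundedSeries N (m ℕ.* n) N≤mn) i i≤N)
                          (factors-boundedSeries (m ℕ.* n) i)

  -- q Θ′ f for Θ = theta K
  thetaWeighted : ℕ → Series → Series
  thetaWeighted K f = ∑ₛ K (λ k → scale (sign (suc k))
    (scale (+ polyP (suc k)) (shift (polyP (suc k)) f) ⊕ scale (+ polyQ (suc k)) (shift (polyQ (suc k)) f)))

  D-theta : ∀ K f → D (theta K f) ≈ theta K (D f) ⊕ thetaWeighted K f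
  D-theta K f i = begin
      D (f ⊕ ∑ₛ K H) i                  ≡⟨ D-⊕ f (∑ₛ K H) i ⟩
      D f i + D (∑ₛ K H) i              ≡⟨ cong (λ x → D f i + x) (trans (D-∑ₛ K H i) (∑-cong′ K D-term)) ⟩
      D f i + ∑ K (λ k → a k + b k)     ≡⟨ cong (λ x → D f i + x) (∑-+ K a b) ⟩
      D f i + (∑ K a + ∑ K b)           ≡⟨ sym (ZP.+-assoc (D f i) (∑ K a) (∑ K b)) ⟩
      theta K (D f) i + thetaWeighted K f i  ∎
    where
      open ≡-Reasoning
      P′ = λ k → polyP (suc k)
      Q′ = λ k → polyQ (suc k)
      H = λ k → scale (sign (suc k)) (shift (P′ k) f ⊕ shift (Q′ k) f)
      a = λ k → sign (suc k) * (shift (P′ k) (D f) i + shift (Q′ k) (D f) i)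
      b = λ k → sign (suc k) * (+ P′ k * shift (P′ k) f i + + Q′ k * shift (Q′ k) f i)
      interchange-* : ∀ s x y u w → s * ((x + y) + (u + w)) ≡ s * (x + u) + s * (y + w)
      interchange-* = solve-∀
      D-term : ∀ k → D (H k) i ≡ a k + b k
      D-term k = begin
          D (H k) i
            ≡⟨ D-scale (sign (suc k)) (shift (P′ k) f ⊕ shift (Q′ k) f) i ⟩
          sign (suc k) * D (shift (P′ k) f ⊕ shift (Q′ k) f) i
            ≡⟨ cong (λ x → sign (suc k) * x)
                 (trans (D-⊕ (shift (P′ k) f) (shift (Q′ k) f) i) (cong₂ _+_ (D-shift (P′ k) f i) (D-shift (Q′ k) f i))) ⟩
          sign (suc k) * ((shift (P′ k) (D f) i + + P′ k * shift (P′ k) f i) + (shift (Q′ k) (D f) i + + Q′ k * shift (Q′ k) f i))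
            ≡⟨ interchange-* (sign (suc k)) (shift (P′ k) (D f) i) (+ P′ k * shift (P′ k) f i) (shift (Q′ k) (D f) i) (+ Q′ k * shift (Q′ k) f i) ⟩
          a k + b k
            ∎

  -- D(Θ F) = 0 and D F = S F give Θ (S F) + (q Θ′) F = 0, while Θ (S F) = S (Θ F) = S
  divisorSeries≈-thetaWeighted : ∀ N → divisorSeries N ≈[ N ] (λ i → - thetaWeighted (N ℕ.+ N) partitionSeries i)
  divisorSeries≈-thetaWeighted N i i≤N = begin
      S i
        ≡⟨ sym (trans (conv-resp {S} {S} N (λ _ _ → refl) (theta-partitionSeries N) i i≤N) (conv-1ₛʳ S i)) ⟩
      conv S (theta K F) i
        ≡⟨ sym (trans (theta-resp K N (D-partitionSeries N) i i≤N) (theta-comm K (conv-lsi S) F i)) ⟩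
      theta K (D F) i
        ≡⟨ cancel (theta K (D F) i) (thetaWeighted K F i) ⟩
      (theta K (D F) i + thetaWeighted K F i) - thetaWeighted K F i
        ≡⟨ cong (λ x → x - thetaWeighted K F i) (sym (D-theta K F i)) ⟩
      D (theta K F) i - thetaWeighted K F i
        ≡⟨ cong (λ x → x - thetaWeighted K F i) (trans (D-resp N (theta-partitionSeries N) i i≤N) (D-1ₛ i)) ⟩
      0ℤ - thetaWeighted K F i
        ≡⟨ ZP.+-identityˡ _ ⟩
      - thetaWeighted K F i
        ∎
    where
      open ≡-Reasoning
      K = N ℕ.+ N
      F = partitionSeries
      S = divisorSeries N
      cancel : ∀ x y → x ≡ (x + y) - y
      cancel = solve-∀

  -1^≡sign : ∀ k → -1ℤ ℤ.^ k ≡ sign k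
  -1^≡sign zero = refl
  -1^≡sign (suc k) = trans (ZP.-1*i≡-i (-1ℤ ℤ.^ k)) (cong -_ (-1^≡sign k))

  m+2∸4≡ : m ℕ.+ 2 ∸ 4 ≡ suc p
  m+2∸4≡ = trans (cong (λ c → c ℕ.+ 2 ∸ 4) m≡3+p) (trans (cong (_∸ 4) (regroup p)) (NP.m+n∸n≡m (suc p) 4))
    where regroup : ∀ p → 3 ℕ.+ p ℕ.+ 2 ≡ suc p ℕ.+ 4
          regroup = NS.solve-∀

  P-numerator : ∀ k → k ℕ.* ((m ℕ.+ 2 ∸ 2) ℕ.* k ∸ (m ℕ.+ 2 ∸ 4)) ≡ polyP k ℕ.* 2
  P-numerator zero = sym (cong (ℕ._* 2) (trans (NP.+-identityʳ (m ℕ.* 0)) (NP.*-zeroʳ m)))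
  P-numerator (suc k) = begin
      suc k ℕ.* ((m ℕ.+ 2 ∸ 2) ℕ.* suc k ∸ (m ℕ.+ 2 ∸ 4))
        ≡⟨ cong₂ (λ a b → suc k ℕ.* (a ℕ.* suc k ∸ b)) (NP.m+n∸n≡m m 2) m+2∸4≡ ⟩
      suc k ℕ.* (m ℕ.* suc k ∸ suc p)
        ≡⟨ cong (λ c → suc k ℕ.* (c ℕ.* suc k ∸ suc p)) m≡3+p ⟩
      suc k ℕ.* ((3 ℕ.+ p) ℕ.* suc k ∸ suc p)
        ≡⟨ cong (λ x → suc k ℕ.* (x ∸ suc p)) (regroup p k) ⟩
      suc k ℕ.* ((2 ℕ.+ (3 ℕ.+ p) ℕ.* k) ℕ.+ suc p ∸ suc p)
        ≡⟨ cong (suc k ℕ.*_) (NP.m+n∸n≡m _ (suc p)) ⟩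
      suc k ℕ.* (2 ℕ.+ (3 ℕ.+ p) ℕ.* k)
        ≡⟨ expand p k ⟩
      (3 ℕ.+ p) ℕ.* (k ℕ.* suc k) ℕ.+ suc k ℕ.* 2
        ≡⟨ cong (λ t → (3 ℕ.+ p) ℕ.* t ℕ.+ suc k ℕ.* 2) (sym (triangular-double k)) ⟩
      (3 ℕ.+ p) ℕ.* (triangular (suc k) ℕ.+ triangular (suc k)) ℕ.+ suc k ℕ.* 2
        ≡⟨ collect p (triangular (suc k)) k ⟩
      ((3 ℕ.+ p) ℕ.* triangular (suc k) ℕ.+ suc k) ℕ.* 2
        ≡⟨ cong (λ c → (c ℕ.* triangular (suc k) ℕ.+ suc k) ℕ.* 2) (sym m≡3+p) ⟩
      polyP (suc k) ℕ.* 2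
        ∎
    where
      open ≡-Reasoning
      regroup : ∀ p k → (3 ℕ.+ p) ℕ.* suc k ≡ (2 ℕ.+ (3 ℕ.+ p) ℕ.* k) ℕ.+ suc p
      regroup = NS.solve-∀
      expand : ∀ p k → suc k ℕ.* (2 ℕ.+ (3 ℕ.+ p) ℕ.* k) ≡ (3 ℕ.+ p) ℕ.* (k ℕ.* suc k) ℕ.+ suc k ℕ.* 2
      expand = NS.solve-∀
      collect : ∀ p t k → (3 ℕ.+ p) ℕ.* (t ℕ.+ t) ℕ.+ suc k ℕ.* 2 ≡ ((3 ℕ.+ p) ℕ.* t ℕ.+ suc k) ℕ.* 2
      collect = NS.solve-∀

  Q-numerator : ∀ k → k ℕ.* ((m ℕ.+ 2 ∸ 2) ℕ.* k ℕ.+ (m ℕ.+ 2 ∸ 4)) ≡ polyQ k ℕ.* 2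
  Q-numerator k = begin
      k ℕ.* ((m ℕ.+ 2 ∸ 2) ℕ.* k ℕ.+ (m ℕ.+ 2 ∸ 4))
        ≡⟨ cong₂ (λ a b → k ℕ.* (a ℕ.* k ℕ.+ b)) (NP.m+n∸n≡m m 2) m+2∸4≡ ⟩
      k ℕ.* (m ℕ.* k ℕ.+ suc p)
        ≡⟨ cong (λ c → k ℕ.* (c ℕ.* k ℕ.+ suc p)) m≡3+p ⟩
      k ℕ.* ((3 ℕ.+ p) ℕ.* k ℕ.+ suc p)
        ≡⟨ expand p k ⟩
      (3 ℕ.+ p) ℕ.* (k ℕ.* k) ℕ.+ suc p ℕ.* k
        ≡⟨ cong (λ x → (3 ℕ.+ p) ℕ.* x ℕ.+ suc p ℕ.* k) (sym (triangular-square k)) ⟩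
      (3 ℕ.+ p) ℕ.* (triangular k ℕ.+ triangular k ℕ.+ k) ℕ.+ suc p ℕ.* k
        ≡⟨ collect p (triangular k) k ⟩
      ((3 ℕ.+ p) ℕ.* triangular k ℕ.+ (2 ℕ.+ p) ℕ.* k) ℕ.* 2
        ≡⟨ cong (λ c → (c ℕ.* triangular k ℕ.+ (c ∸ 1) ℕ.* k) ℕ.* 2) (sym m≡3+p) ⟩
      polyQ k ℕ.* 2
        ∎
    where
      open ≡-Reasoning
      expand : ∀ p k → k ℕ.* ((3 ℕ.+ p) ℕ.* k ℕ.+ suc p) ≡ (3 ℕ.+ p) ℕ.* (k ℕ.* k) ℕ.+ suc p ℕ.* k
      expand = NS.solve-∀
      collect : ∀ p t k → (3 ℕ.+ p) ℕ.* (t ℕ.+ t ℕ.+ k) ℕ.+ suc p ℕ.* k ≡ ((3 ℕ.+ p) ℕ.* t ℕ.+ (2 ℕ.+ p) ℕ.* k) ℕ.* 2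
      collect = NS.solve-∀

  P≡polyP : ∀ k → P (m ℕ.+ 2) k ≡ polyP k
  P≡polyP k = trans (cong (_/ 2) (P-numerator k)) (m*n/n≡m (polyP k) 2)

  Q≡polyQ : ∀ k → Q (m ℕ.+ 2) k ≡ polyQ k
  Q≡polyQ k = trans (cong (_/ 2) (Q-numerator k)) (m*n/n≡m (polyQ k) 2)

  p′ℤ-shift : ∀ a n → + (a ℕ.* p′ℤ m (+ n - + a)) ≡ + a * shift a partitionSeries n
  p′ℤ-shift a n with a ℕ.≤? n
  ... | yes a≤n = begin
      + (a ℕ.* p′ℤ m (+ n - + a))        ≡⟨ cong (λ z → + (a ℕ.* p′ℤ m z)) (trans (ZP.m-n≡m⊖n n a) (ZP.⊖-≥ a≤n)) ⟩
      + (a ℕ.* p′ m (n ∸ a))             ≡⟨ ZP.pos-* a (p′ m (n ∸ a)) ⟩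
      + a * partitionSeries (n ∸ a)      ≡⟨ cong (λ x → + a * x) (sym (shift-≥ a partitionSeries n a≤n)) ⟩
      + a * shift a partitionSeries n    ∎
    where open ≡-Reasoning
  ... | no a≰n = begin
      + (a ℕ.* p′ℤ m (+ n - + a))        ≡⟨ cong (λ z → + (a ℕ.* p′ℤ m z)) (trans (ZP.m-n≡m⊖n n a) (ZP.⊖-< n<a)) ⟩
      + (a ℕ.* p′ℤ m (- + (a ∸ n)))      ≡⟨ cong (λ z → + (a ℕ.* z)) (negative (a ∸ n) (NP.m<n⇒0<n∸m n<a)) ⟩
      + (a ℕ.* 0)                        ≡⟨ cong +_ (NP.*-zeroʳ a) ⟩
      0ℤ                                 ≡⟨ sym (ZP.*-zeroʳ (+ a)) ⟩
      + a * 0ℤ                           ≡⟨ cong (λ x → + a * x) (sym (shift-< a partitionSeries n n<a)) ⟩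
      + a * shift a partitionSeries n    ∎
    where open ≡-Reasoning
          n<a = NP.≰⇒> a≰n
          negative : ∀ y → 0 < y → p′ℤ m (- + y) ≡ 0
          negative (suc y) _ = refl

  weightedTerm : ℕ → ℕ → ℤ
  weightedTerm n k = sign (suc k) * (+ polyP (suc k) * shift (polyP (suc k)) partitionSeries n
                                    + + polyQ (suc k) * shift (polyQ (suc k)) partitionSeries n)

  term-suc : ∀ n k → term m n (suc k) ≡ - weightedTerm n k
  term-suc n k = begin
      (-1ℤ ℤ.^ suc (suc k)) * (+ (P (m ℕ.+ 2) (suc k) ℕ.* p′ℤ m (+ n - + P (m ℕ.+ 2) (suc k)))
                             + + (Q (m ℕ.+ 2) (suc k) ℕ.* p′ℤ m (+ n - + Q (m ℕ.+ 2) (suc k))))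
        ≡⟨ cong₂ _*_ (-1^≡sign (suc (suc k)))
             (cong₂ _+_ (trans (cong (λ z → + (z ℕ.* p′ℤ m (+ n - + z))) (P≡polyP (suc k))) (p′ℤ-shift (polyP (suc k)) n))
                        (trans (cong (λ z → + (z ℕ.* p′ℤ m (+ n - + z))) (Q≡polyQ (suc k))) (p′ℤ-shift (polyQ (suc k)) n))) ⟩
      - sign (suc k) * X
        ≡⟨ sym (ZP.neg-distribˡ-* (sign (suc k)) X) ⟩
      - weightedTerm n k
        ∎
    where open ≡-Reasoning
          X = + polyP (suc k) * shift (polyP (suc k)) partitionSeries n + + polyQ (suc k) * shift (polyQ (suc k)) partitionSeries n

  thetaWeighted≡∑term : ∀ n K → - thetaWeighted K partitionSeries n ≡ ∑ K (λ k → term m n (suc k))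
  thetaWeighted≡∑term n K = trans (sym (∑-neg K (weightedTerm n))) (∑-cong′ K (λ k → sym (term-suc n k)))

  term-vanish : ∀ n k → n ≤ k → term m n (suc k) ≡ 0ℤ
  term-vanish n k n≤k = begin
      term m n (suc k)
        ≡⟨ term-suc n k ⟩
      - (sign (suc k) * (+ polyP (suc k) * shift (polyP (suc k)) F n + + polyQ (suc k) * shift (polyQ (suc k)) F n))
        ≡⟨ cong (λ x → - (sign (suc k) * x)) (cong₂ _+_ (beyond (polyP (suc k)) (polyP-≥ (suc k))) (beyond (polyQ (suc k)) (polyQ-≥ (suc k)))) ⟩
      - (sign (suc k) * (0ℤ + 0ℤ))
        ≡⟨ cong -_ (ZP.*-zeroʳ (sign (suc k))) ⟩
      0ℤ
        ∎
    where
      open ≡-Reasoning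
      F = partitionSeries
      beyond : ∀ e → suc k ≤ e → + e * shift e F n ≡ 0ℤ
      beyond e k<e = trans (cong (λ x → + e * x) (shift-< e F n (NP.<-≤-trans (s≤s n≤k) k<e))) (ZP.*-zeroʳ (+ e))

  sumTo-∑ : ∀ (f : ℕ → ℤ) N → sumTo f N ≡ f 0 + ∑ N (f ∘ suc)
  sumTo-∑ f zero = sym (ZP.+-identityʳ (f 0))
  sumTo-∑ f (suc N) = trans (cong (λ x → x + f (suc N)) (sumTo-∑ f N))
    (trans (ZP.+-assoc (f 0) _ _) (cong (λ x → f 0 + x) (sym (∑-snoc N (f ∘ suc)))))

open import Data.Nat using (suc; _+_; _∸_)
open import Data.Nat.Properties using (≤-refl; m+[n∸m]≡n)
open import Data.Integer using (+_; -_)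
open import Data.Integer.Properties using (+-identityˡ)
open import Relation.Binary.PropositionalEquality using (_≡_; sym; trans; cong; module ≡-Reasoning)
open import Defs

theorem8 : (m n : ℕ) → 3 ≤ m → 1 ≤ n → (N : ℕ) → n ≤ N →
    + σ′ m n ≡ sumTo (term m n) N
theorem8 m (suc j) m≥3 _ N n≤N = begin
    + σ′ m n                                           ≡⟨ sym (divisorSeries≡σ′ n j ≤-refl) ⟩
    divisorSeries n n                                  ≡⟨ divisorSeries≈-thetaWeighted n n ≤-refl ⟩
    - thetaWeighted (n + n) partitionSeries n          ≡⟨ thetaWeighted≡∑term n (n + n) ⟩
    ∑ (n + n) (λ k → term m n (suc k))                 ≡⟨ ∑-truncate n n _ (term-vanish n) ⟩
    ∑ n (λ k → term m n (suc k))                       ≡⟨ sym (∑-truncate n (N ∸ n) _ (term-vanish n)) ⟩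
    ∑ (n + (N ∸ n)) (λ k → term m n (suc k))           ≡⟨ cong (λ K → ∑ K (λ k → term m n (suc k))) (m+[n∸m]≡n n≤N) ⟩
    ∑ N (λ k → term m n (suc k))                       ≡⟨ sym (trans (sumTo-∑ (term m n) N) (+-identityˡ _)) ⟩
    sumTo (term m n) N                                 ∎
  where
    -- the last step uses that term m n 0 reduces to 0ℤ, as P_{m+2,0} = Q_{m+2,0} = 0
    open ≡-Reasoning
    open PowerSeries
    open PartitionSeries m
    open Identity m m≥3
    n = suc j
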